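{- Consider the octal game $\mathbf{4.7}$ in mis\`ere play. Let $\mathscr{A}$ be the free commutative monoid on the heaps $H_1,H_2,H_3,\ldots$, so that every position is a finite sum $G=\sum_k m_k H_k$. Let $\mathcal{Q}$ be the commutative monoid with presentation \[\mathcal{Q}=\langle a,\,b,\,c,\,d_0,d_1,d_2,\ldots \mid a^2=1,\ bc=ab^3,\ c^2=b^4,\ b^{n+1}d_n=a^{n+1}b^{2n+5},\ cd_n=ab^2d_n\ (n\ge0),\ d_md_n=a^{m+1}b^{m+4}d_n\ (0\le m\le n)\rangle,\] and let \[\mathcal{P}=\{a\}\cup\{b^{2m}:m\ge1\}\cup\{b^md_n: m \text{ odd},\ n\text{ even},\ m<n\}\cup\{ab^md_n: m\text{ even},\ n\text{ odd},\ m<n\}\subseteq\mathcal{Q}.\] Let $\Phi:\mathscr{A}\to\mathcal{Q}$ be the monoid homomorphism determined by $\Phi(H_1)=\Phi(H_3)=a$, $\Phi(H_2)=\Phi(H_4)=b$, $\Phi(H_5)=c$, $\Phi(H_6)=b^3$, and $\Phi(H_k)=d_{k-7}$ for $k\ge 7$. Then for every position $G\in\mathscr{A}$, $G$ is a mis\`ere $\mathscr{P}$-position if and only if $\Phi(G)\in\mathcal{P}$.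
   Context: The octal game $\mathbf{4.7}$ is played on a disjunctive sum of heaps of beans; a move consists of choosing one heap and either (i) splitting it, without removing any beans, into two nonempty heaps, or (ii) removing exactly 1 bean from it and leaving the remainder as zero heaps (only possible if the heap had 1 bean), one nonempty heap, or two nonempty heaps. $H_k$ denotes a single heap of $k$ beans. In mis\`ere play, the player who makes the last move loses. A position is a mis\`ere $\mathscr{P}$-position if the player about to move loses with perfect play; recursively, $G$ is a $\mathscr{P}$-position iff $G$ has at least one option and every option of $G$ is not a $\mathscr{P}$-position (a position with no moves is therefore not a $\mathscr{P}$-position). -}

module Defs where

open import Data.Nat using (ℕ; zero; suc; _+_; _*_; _≤_; _<_)
open import Data.List using (List; []; _∷_; _++_; [_]; replicate; concatMap)
open import Data.Product using (Σ; ∃; _×_; _,_)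
open import Relation.Binary.PropositionalEquality using (_≡_)
open import Relation.Nullary using (¬_)

-- Positions of 4.7: a finite multiset of heaps, represented as a list of
-- heap sizes (order irrelevant: moves act on any heap in the list).
-- Genuine positions contain only nonempty heaps (sizes ≥ 1).

Position : Set
Position = List ℕ

data HeapOption : ℕ → List ℕ → Set where
  split   : ∀ i j → HeapOption (suc i + suc j) (suc i ∷ suc j ∷ [])
  remove0 : HeapOption 1 []
  remove1 : ∀ i → HeapOption (suc (suc i)) (suc i ∷ [])
  remove2 : ∀ i j → HeapOption (suc (suc i + suc j)) (suc i ∷ suc j ∷ [])

data Move : Position → Position → Set where
  move : ∀ xs k ys R → HeapOption k R → Move (xs ++ k ∷ ys) (xs ++ R ++ ys)

-- IsP G : G has an option and every option is an N-position;
-- IsN G : G has no options, or some option is a P-position.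
-- (Inductive = well-founded recursion, since 4.7 is a short game.)
mutual
  data IsP : Position → Set where
    isP : ∀ {G} → (∃ λ G' → Move G G') →
          (∀ G' → Move G G' → IsN G') → IsP G

  data IsN : Position → Set where
    terminal : ∀ {G} → (∀ G' → ¬ Move G G') → IsN G
    toP      : ∀ {G G'} → Move G G' → IsP G' → IsN G

data Gen : Set where
  a b c : Gen
  d     : ℕ → Gen

Word : Set
Word = List Gen

pow : ℕ → Gen → Word
pow n x = replicate n x

data Relation : Word → Word → Set where
  r-aa : Relation (a ∷ a ∷ []) []
  r-bc : Relation (b ∷ c ∷ []) (a ∷ pow 3 b)
  r-cc : Relation (c ∷ c ∷ []) (pow 4 b)
  r-bd : ∀ n → Relation (pow (suc n) b ++ [ d n ])
                        (pow (suc n) a ++ pow (2 * n + 5) b)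
  r-cd : ∀ n → Relation (c ∷ d n ∷ []) (a ∷ b ∷ b ∷ d n ∷ [])
  r-dd : ∀ m n → m ≤ n →
         Relation (d m ∷ d n ∷ []) (pow (suc m) a ++ pow (m + 4) b ++ [ d n ])

-- The congruence on the free monoid generated by commutativity and the
-- defining relations; Q = Word / _≈Q_.
data _≈Q_ : Word → Word → Set where
  ≈refl  : ∀ {u} → u ≈Q u
  ≈sym   : ∀ {u v} → u ≈Q v → v ≈Q u
  ≈trans : ∀ {u v w} → u ≈Q v → v ≈Q w → u ≈Q w
  ≈comm  : ∀ xs x y ys → (xs ++ x ∷ y ∷ ys) ≈Q (xs ++ y ∷ x ∷ ys)
  ≈rel   : ∀ xs {l r} ys → Relation l r → (xs ++ l ++ ys) ≈Q (xs ++ r ++ ys)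

Even Odd : ℕ → Set
Even m = ∃ λ k → m ≡ 2 * k
Odd  m = ∃ λ k → m ≡ suc (2 * k)

data PWord : Word → Set where
  p-a  : PWord [ a ]
  p-b  : ∀ m → 1 ≤ m → PWord (pow (2 * m) b)
  p-d  : ∀ m n → Odd m → Even n → m < n → PWord (pow m b ++ [ d n ])
  p-ad : ∀ m n → Even m → Odd n → m < n → PWord (a ∷ pow m b ++ [ d n ])

_∈𝒫 : Word → Set
w ∈𝒫 = ∃ λ p → PWord p × (w ≈Q p)

φ : ℕ → Word
φ 0 = []            -- irrelevant: positions have no empty heaps
φ 1 = [ a ]
φ 2 = [ b ]
φ 3 = [ a ]
φ 4 = [ b ]
φ 5 = [ c ]
φ 6 = pow 3 b
φ (suc (suc (suc (suc (suc (suc (suc k))))))) = [ d k ]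

Φ : Position → Word
Φ G = concatMap φ G

-- A value monoid: words in a, b, c, d_n are evaluated in a commutative monoid of forms a^i b^j t with
-- t ∈ {1, c, d_n}, and a Boolean test inP on these forms is shown to be invariant, in every context, under
-- the defining relations of Q; together with explicit normal forms this identifies inP ∘ eval with
-- membership in 𝒫. The game is then handled by induction on a weight that every move lowers. From a
-- position whose value passes inP no move leads to another one: a move to two heaps or to none changes the
-- parity of the number of heaps, which inP can only survive through the value a, and a move to one heap
-- changes a single exponent or d-index by one. From every other nonempty position an explicit option of a
-- largest heap, or of a heap carrying b, reaches a value passing inP.

module Submission where

open import Defs
open import Algebra.Bundles using (CommutativeMonoid; CommutativeRing)
import Algebra.Solver.CommutativeMonoid
open import Data.Bool using (Bool; true; false; not; _∧_; _xor_)
open import Data.Bool.Properties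
  using (not-involutive; ¬-not; not-distribʳ-xor; xor-assoc; xor-comm; xor-identityʳ; xor-same; not-distribˡ-xor; xor-∧-commutativeRing)
open import Data.Nat using (ℕ; zero; suc; _+_; _*_; _≤_; _<_; z≤n; s≤s; _⊓_; _⊔_; _≤?_; _≟_)
open import Data.Nat.Properties
open import Data.Nat.Tactic.RingSolver using (solve-∀)
open import Data.List using (List; []; _∷_; _++_; [_])
open import Data.List.Properties using (++-assoc; ++-identityʳ)
open import Data.List.Relation.Unary.All as All using (All; []; _∷_)
open import Data.List.Relation.Unary.Any using (here; there)
open import Data.List.Membership.Propositional using (_∈_)
open import Data.List.Membership.Propositional.Properties using (∈-∃++)
open import Data.List.Relation.Binary.Permutation.Propositional as ↭
  using (_↭_; ↭-refl; ↭-prep; ↭-swap; ↭-trans; ↭-sym)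
open import Data.List.Relation.Binary.Permutation.Propositional.Properties
  using (shift; shifts; drop-∷; ∈-resp-↭; All-resp-↭)
open import Data.Product using (Σ; _×_; _,_; proj₁; proj₂)
open import Data.Sum using (_⊎_; inj₁; inj₂)
open import Data.Empty using (⊥; ⊥-elim)
open import Relation.Nullary using (¬_; yes; no)
open import Function.Bundles using (_⇔_; mk⇔)
open import Function.Properties.Equivalence using () renaming (trans to ⇔-trans)
open import Relation.Binary.PropositionalEquality hiding ([_])
open import Relation.Binary.Definitions using (tri<; tri≈; tri>)

odd : ℕ → Bool
odd zero    = false
odd (suc n) = not (odd n)

odd-+ : ∀ m n → odd (m + n) ≡ odd m xor odd n
odd-+ zero    n = refl
odd-+ (suc m) n rewrite odd-+ m n = not-distribˡ-xor (odd m) (odd n)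

module _ {c ℓ} (M : CommutativeMonoid c ℓ) where
  open CommutativeMonoid M using (_≈_; _∙_; ∙-congʳ) renaming (refl to ≈-refl)
  open import Algebra.Solver.CommutativeMonoid M using (solve; _⊜_; _⊕_)
  open import Relation.Binary.Reasoning.Setoid (CommutativeMonoid.setoid M)

  ∙-assoc-corrected : ∀ p q r s x y z → p ∙ q ≈ r ∙ s →
                      q ∙ ((p ∙ (x ∙ y)) ∙ z) ≈ s ∙ (x ∙ (r ∙ (y ∙ z)))
  ∙-assoc-corrected p q r s x y z pq≈rs = begin
    q ∙ ((p ∙ (x ∙ y)) ∙ z)
      ≈⟨ solve 5 (λ x y z p q → q ⊕ ((p ⊕ (x ⊕ y)) ⊕ z) ⊜ (p ⊕ q) ⊕ (x ⊕ (y ⊕ z))) ≈-refl x y z p q ⟩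
    (p ∙ q) ∙ (x ∙ (y ∙ z))
      ≈⟨ ∙-congʳ pq≈rs ⟩
    (r ∙ s) ∙ (x ∙ (y ∙ z))
      ≈⟨ solve 5 (λ x y z r s → (r ⊕ s) ⊕ (x ⊕ (y ⊕ z)) ⊜ s ⊕ (x ⊕ (r ⊕ (y ⊕ z)))) ≈-refl x y z r s ⟩
    s ∙ (x ∙ (r ∙ (y ∙ z))) ∎

xor-commutativeMonoid : CommutativeMonoid _ _
xor-commutativeMonoid = CommutativeRing.+-commutativeMonoid xor-∧-commutativeRing

module XorSolver = Algebra.Solver.CommutativeMonoid xor-commutativeMonoid

-- A commutative monoid of forms a^i b^j t

data Tail : Set where
  one : Tail
  c′  : Tail
  d′  : ℕ → Tail

infix 5 a^_b^_·_
record Elt : Set where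
  constructor a^_b^_·_
  field
    aBit   : Bool
    bExp   : ℕ
    tailOf : Tail
open Elt

Elt-cong : ∀ {i i′ j j′ t t′} → i ≡ i′ → j ≡ j′ → t ≡ t′ → (a^ i b^ j · t) ≡ (a^ i′ b^ j′ · t′)
Elt-cong refl refl refl = refl

-- Only a² = 1, c² = b⁴, cd = ab²d and d_m d_n = a^(m+1) b^(m+4) d_n are built into the product;
-- bc = ab³ and b^(n+1) d_n = a^(n+1) b^(2n+5) are respected by inP alone (relation⇒≋).
_⋆_ : Tail → Tail → Elt
one  ⋆ t    = a^ false b^ 0 · t
c′   ⋆ one  = a^ false b^ 0 · c′
c′   ⋆ c′   = a^ false b^ 4 · one
c′   ⋆ d′ m = a^ true b^ 2 · d′ m
d′ n ⋆ one  = a^ false b^ 0 · d′ n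
d′ n ⋆ c′   = a^ true b^ 2 · d′ n
d′ n ⋆ d′ m = a^ not (odd (n ⊓ m)) b^ n ⊓ m + 4 · d′ (n ⊔ m)

infixl 7 _⊗_
_⊗_ : Elt → Elt → Elt
(a^ i b^ j · s) ⊗ (a^ i′ b^ j′ · t) =
  a^ aBit (s ⋆ t) xor (i xor i′) b^ bExp (s ⋆ t) + (j + j′) · tailOf (s ⋆ t)

ε : Elt
ε = a^ false b^ 0 · one

⋆-comm : ∀ s t → s ⋆ t ≡ t ⋆ s
⋆-comm one    one    = refl
⋆-comm one    c′     = refl
⋆-comm one    (d′ _) = refl
⋆-comm c′     one    = refl
⋆-comm c′     c′     = refl
⋆-comm c′     (d′ _) = refl
⋆-comm (d′ _) one    = refl
⋆-comm (d′ _) c′     = refl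
⋆-comm (d′ n) (d′ m) rewrite ⊓-comm n m | ⊔-comm n m = refl

⊗-comm : ∀ x y → x ⊗ y ≡ y ⊗ x
⊗-comm (a^ i b^ j · s) (a^ i′ b^ j′ · t) rewrite ⋆-comm s t | +-comm j j′ | xor-comm i i′ = refl

⊗-identityˡ : ∀ x → ε ⊗ x ≡ x
⊗-identityˡ _ = refl

⊗-identityʳ : ∀ x → x ⊗ ε ≡ x
⊗-identityʳ x = trans (⊗-comm x ε) (⊗-identityˡ x)

SamePair : ℕ → ℕ → ℕ → ℕ → Set
SamePair x y u v = (x ≡ u × y ≡ v) ⊎ (x ≡ v × y ≡ u)

⊓-⊔-samePair : ∀ x y z → SamePair (x ⊓ y) ((x ⊔ y) ⊓ z) (y ⊓ z) (x ⊓ (y ⊔ z))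
⊓-⊔-samePair zero    y       z       = inj₂ (refl , refl)
⊓-⊔-samePair (suc x) zero    z       = inj₁ (refl , refl)
⊓-⊔-samePair (suc x) (suc y) zero    = inj₂ (refl , refl)
⊓-⊔-samePair (suc x) (suc y) (suc z) with ⊓-⊔-samePair x y z
... | inj₁ (p , q) = inj₁ (cong suc p , cong suc q)
... | inj₂ (p , q) = inj₂ (cong suc p , cong suc q)

samePair-sum : ∀ {A : Set} (_∙_ : A → A → A) → (∀ x y → x ∙ y ≡ y ∙ x) → (f : ℕ → A) →
               ∀ {x y u v} → SamePair x y u v → f x ∙ f y ≡ f u ∙ f v
samePair-sum _∙_ comm f (inj₁ (refl , refl)) = refl
samePair-sum _∙_ comm f (inj₂ (refl , refl)) = comm _ _

record TailAssoc (p q r s : Elt) : Set where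
  field
    bits  : aBit p xor aBit q ≡ aBit r xor aBit s
    exps  : bExp p + bExp q ≡ bExp r + bExp s
    tails : tailOf q ≡ tailOf s

⋆-assoc : ∀ t₁ t₂ t₃ → TailAssoc (t₁ ⋆ t₂) (tailOf (t₁ ⋆ t₂) ⋆ t₃) (t₂ ⋆ t₃) (t₁ ⋆ tailOf (t₂ ⋆ t₃))
⋆-assoc one      t₂       t₃       = record { bits = sym (xor-identityʳ _) ; exps = sym (+-identityʳ _) ; tails = refl }
⋆-assoc c′       one      t₃       = record { bits = refl ; exps = refl ; tails = refl }
⋆-assoc c′       c′       one      = record { bits = refl ; exps = refl ; tails = refl }
⋆-assoc c′       c′       c′       = record { bits = refl ; exps = refl ; tails = refl }
⋆-assoc c′       c′       (d′ _)   = record { bits = refl ; exps = refl ; tails = refl }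
⋆-assoc c′       (d′ _)   one      = record { bits = refl ; exps = refl ; tails = refl }
⋆-assoc c′       (d′ _)   c′       = record { bits = refl ; exps = refl ; tails = refl }
⋆-assoc c′       (d′ _)   (d′ _)   = record { bits = xor-comm true _ ; exps = +-comm 2 _ ; tails = refl }
⋆-assoc (d′ _)   one      t₃       = record { bits = refl ; exps = refl ; tails = refl }
⋆-assoc (d′ _)   c′       one      = record { bits = refl ; exps = refl ; tails = refl }
⋆-assoc (d′ _)   c′       c′       = record { bits = refl ; exps = refl ; tails = refl }
⋆-assoc (d′ _)   c′       (d′ _)   = record { bits = refl ; exps = refl ; tails = refl }
⋆-assoc (d′ _)   (d′ _)   one      = record { bits = xor-identityʳ _ ; exps = +-identityʳ _ ; tails = refl }
⋆-assoc (d′ _)   (d′ _)   c′       = record { bits = xor-comm _ true ; exps = +-comm _ 2 ; tails = refl }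
⋆-assoc (d′ x)   (d′ y)   (d′ z)   = record
  { bits  = samePair-sum _xor_ xor-comm (λ n → not (odd n)) (⊓-⊔-samePair x y z)
  ; exps  = samePair-sum _+_ +-comm (_+ 4) (⊓-⊔-samePair x y z)
  ; tails = cong d′ (⊔-assoc x y z)
  }

⊗-assoc : ∀ x y z → (x ⊗ y) ⊗ z ≡ x ⊗ (y ⊗ z)
⊗-assoc (a^ i₁ b^ j₁ · t₁) (a^ i₂ b^ j₂ · t₂) (a^ i₃ b^ j₃ · t₃) = Elt-cong
  (∙-assoc-corrected xor-commutativeMonoid (aBit p) (aBit q) (aBit r) (aBit s) i₁ i₂ i₃ bits)
  (∙-assoc-corrected +-0-commutativeMonoid (bExp p) (bExp q) (bExp r) (bExp s) j₁ j₂ j₃ exps)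
  tails
  where
  p = t₁ ⋆ t₂
  q = tailOf p ⋆ t₃
  r = t₂ ⋆ t₃
  s = t₁ ⋆ tailOf r
  open TailAssoc (⋆-assoc t₁ t₂ t₃)

⊗-swapˡ : ∀ x y z → x ⊗ (y ⊗ z) ≡ y ⊗ (x ⊗ z)
⊗-swapˡ x y z = trans (sym (⊗-assoc x y z)) (trans (cong (_⊗ z) (⊗-comm x y)) (⊗-assoc y x z))

-- The test for 𝒫

sameBit : Bool → Bool → Bool
sameBit x y = not (x xor y)

plainInP : Bool → ℕ → Bool
plainInP true  zero          = true
plainInP true  (suc _)       = false
plainInP false zero          = false
plainInP false (suc zero)    = false
plainInP false (suc (suc j)) = not (odd j)

data Comparison : Set where
  LT EQ GT : Comparison

compareℕ : ℕ → ℕ → Comparison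
compareℕ zero    zero    = EQ
compareℕ zero    (suc _) = LT
compareℕ (suc _) zero    = GT
compareℕ (suc m) (suc n) = compareℕ m n

compareℕ-< : ∀ {m n} → m < n → compareℕ m n ≡ LT
compareℕ-< {zero}  {suc n} _       = refl
compareℕ-< {suc m} {suc n} (s≤s p) = compareℕ-< p

compareℕ-> : ∀ {m n} → n < m → compareℕ m n ≡ GT
compareℕ-> {suc m} {zero}  _       = refl
compareℕ-> {suc m} {suc n} (s≤s p) = compareℕ-> p

compareℕ-≡ : ∀ n → compareℕ n n ≡ EQ
compareℕ-≡ zero    = refl
compareℕ-≡ (suc n) = compareℕ-≡ n

-- For j > n the relation b^(n+1) d_n = a^(n+1) b^(2n+5) turns a^i b^j d_n into a^(i+n+1) b^(j+n+4).
dInPBy : Comparison → Bool → ℕ → ℕ → Bool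
dInPBy LT i j n = sameBit i (odd n) ∧ sameBit (odd j) (not (odd n))
dInPBy EQ i j n = false
dInPBy GT i j n = plainInP (i xor not (odd n)) (j + n + 4)

dInP : Bool → ℕ → ℕ → Bool
dInP i j n = dInPBy (compareℕ j n) i j n

-- A b-exponent beside c is reduced with bc = ab³; b⁰c is c itself.
inP : Elt → Bool
inP (a^ i b^ j     · one)  = plainInP i j
inP (a^ i b^ zero  · c′)   = false
inP (a^ i b^ suc j · c′)   = plainInP (not i) (3 + j)
inP (a^ i b^ j     · d′ n) = dInP i j n

dInP-< : ∀ i {j n} → j < n → dInP i j n ≡ (sameBit i (odd n) ∧ sameBit (odd j) (not (odd n)))
dInP-< i j<n rewrite compareℕ-< j<n = refl

dInP-> : ∀ i {j n} → n < j → dInP i j n ≡ plainInP (i xor not (odd n)) (j + n + 4)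
dInP-> i n<j rewrite compareℕ-> n<j = refl

dInP-≡ : ∀ i n → dInP i n n ≡ false
dInP-≡ i n rewrite compareℕ-≡ n = refl

genElt : Gen → Elt
genElt a     = a^ true b^ 0 · one
genElt b     = a^ false b^ 1 · one
genElt c     = a^ false b^ 0 · c′
genElt (d n) = a^ false b^ 0 · d′ n

eval : Word → Elt
eval []      = ε
eval (g ∷ w) = genElt g ⊗ eval w

eval-++ : ∀ u v → eval (u ++ v) ≡ eval u ⊗ eval v
eval-++ []      v = sym (⊗-identityˡ (eval v))
eval-++ (g ∷ u) v rewrite eval-++ u v = sym (⊗-assoc (genElt g) (eval u) (eval v))

eval-pow-b : ∀ k → eval (pow k b) ≡ (a^ false b^ k · one)
eval-pow-b zero = refl
eval-pow-b (suc k) rewrite eval-pow-b k = refl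

eval-pow-a : ∀ k → eval (pow k a) ≡ (a^ odd k b^ 0 · one)
eval-pow-a zero = refl
eval-pow-a (suc k) rewrite eval-pow-a k = refl

infix 4 _≋_
_≋_ : Elt → Elt → Set
x ≋ y = ∀ z → inP (z ⊗ x) ≡ inP (z ⊗ y)

≡⇒≋ : ∀ {x y} → x ≡ y → x ≋ y
≡⇒≋ refl z = refl

≋-sym : ∀ {x y} → x ≋ y → y ≋ x
≋-sym p z = sym (p z)

≋-trans : ∀ {x y w} → x ≋ y → y ≋ w → x ≋ w
≋-trans p q z = trans (p z) (q z)

xor-true : ∀ i → i xor true ≡ not i
xor-true i = xor-comm i true

bc≋ab³ : (a^ false b^ 1 · c′) ≋ (a^ true b^ 3 · one)
bc≋ab³ (a^ i b^ j · one) rewrite xor-identityʳ i | +-comm j 1 =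
  cong₂ plainInP (sym (xor-true i)) (+-comm 3 j)
bc≋ab³ (a^ i b^ j · c′) rewrite xor-identityʳ i | +-comm j 3 | +-comm j 1 =
  cong (λ x → plainInP x (5 + j)) (sym (trans (cong not (xor-true i)) (not-involutive i)))
bc≋ab³ (a^ i b^ j · d′ n) =
  cong₂ (λ x y → dInP x y n) (trans (cong not (xor-identityʳ i)) (sym (xor-true i))) (arith j)
  where
  arith : ∀ j → 2 + (j + 1) ≡ j + 3
  arith = solve-∀

inP-c′-suc : ∀ i {j k} → j ≡ suc k → inP (a^ i b^ j · c′) ≡ plainInP (not i) (3 + k)
inP-c′-suc i refl = refl

bⁿ⁺¹dₙ≋aⁿ⁺¹b²ⁿ⁺⁵ : ∀ n → (a^ false b^ suc n · d′ n) ≋ (a^ not (odd n) b^ 2 * n + 5 · one)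
bⁿ⁺¹dₙ≋aⁿ⁺¹b²ⁿ⁺⁵ n (a^ i b^ j · one) rewrite xor-identityʳ i =
  trans (dInP-> i (m≤n+m (suc n) j)) (cong (plainInP (i xor not (odd n))) (arith j n))
  where
  arith : ∀ j n → j + suc n + n + 4 ≡ j + (2 * n + 5)
  arith = solve-∀
bⁿ⁺¹dₙ≋aⁿ⁺¹b²ⁿ⁺⁵ n (a^ i b^ j · c′) rewrite xor-identityʳ i = begin
  dInP (not i) (2 + (j + suc n)) n
    ≡⟨ dInP-> (not i) (m≤n+m (suc n) (2 + j)) ⟩
  plainInP (not i xor not (odd n)) (2 + (j + suc n) + n + 4)
    ≡⟨ cong₂ plainInP (sym (not-distribˡ-xor i _)) (arith₁ j n) ⟩
  plainInP (not (i xor not (odd n))) (3 + (j + 2 * n + 4))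
    ≡⟨ inP-c′-suc _ (arith₂ j n) ⟨
  inP (a^ i xor not (odd n) b^ j + (2 * n + 5) · c′) ∎
  where
  open ≡-Reasoning
  arith₁ : ∀ j n → 2 + (j + suc n) + n + 4 ≡ 3 + (j + 2 * n + 4)
  arith₁ = solve-∀
  arith₂ : ∀ j n → j + (2 * n + 5) ≡ suc (j + 2 * n + 4)
  arith₂ = solve-∀
bⁿ⁺¹dₙ≋aⁿ⁺¹b²ⁿ⁺⁵ n (a^ i b^ j · d′ N) with ≤-total N n
... | inj₁ N≤n rewrite m≤n⇒m⊓n≡m N≤n | m≤n⇒m⊔n≡n N≤n | xor-identityʳ i = begin
  dInP (not (odd N) xor i) (N + 4 + (j + suc n)) n
    ≡⟨ dInP-> _ (≤-trans (m≤n+m (suc n) j) (m≤n+m _ (N + 4))) ⟩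
  plainInP ((not (odd N) xor i) xor not (odd n)) (N + 4 + (j + suc n) + n + 4)
    ≡⟨ cong₂ plainInP (solve 3 (λ x i y → (x ⊕ i) ⊕ y ⊜ (i ⊕ y) ⊕ x) refl (not (odd N)) i (not (odd n))) (arith₁ j n N) ⟩
  plainInP ((i xor not (odd n)) xor not (odd N)) (j + (2 * n + 5) + N + 4)
    ≡⟨ dInP-> (i xor not (odd n)) (≤-trans (s≤s N≤n) (arith₂ j n)) ⟨
  dInP (i xor not (odd n)) (j + (2 * n + 5)) N ∎
  where
  open ≡-Reasoning
  open XorSolver using (solve; _⊕_; _⊜_)
  arith₁ : ∀ j n N → N + 4 + (j + suc n) + n + 4 ≡ j + (2 * n + 5) + N + 4
  arith₁ = solve-∀
  arith₂ : ∀ j n → suc n ≤ j + (2 * n + 5)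
  arith₂ j n = ≤-trans (m≤n+m (suc n) (j + n + 4)) (≤-reflexive (arith₃ j n))
    where
    arith₃ : ∀ j n → j + n + 4 + suc n ≡ j + (2 * n + 5)
    arith₃ = solve-∀
... | inj₂ n≤N rewrite m≥n⇒m⊓n≡n n≤N | m≥n⇒m⊔n≡m n≤N | xor-identityʳ i =
  cong₂ (λ x y → dInP x y N) (xor-comm _ i) (arith j n)
  where
  arith : ∀ j n → n + 4 + (j + suc n) ≡ j + (2 * n + 5)
  arith = solve-∀

eval-dd : ∀ m n → m ≤ n → eval (d m ∷ d n ∷ []) ≡ (a^ not (odd m) b^ m + 4 · d′ n)
eval-dd m n m≤n rewrite m≤n⇒m⊓n≡m m≤n | m≤n⇒m⊔n≡n m≤n | xor-identityʳ (not (odd m)) | +-identityʳ (m + 4) = refl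

eval-aᵐ⁺¹bᵐ⁺⁴dₙ : ∀ m n → eval (pow (suc m) a ++ pow (m + 4) b ++ [ d n ]) ≡ (a^ not (odd m) b^ m + 4 · d′ n)
eval-aᵐ⁺¹bᵐ⁺⁴dₙ m n
  rewrite eval-++ (pow (suc m) a) (pow (m + 4) b ++ [ d n ]) | eval-++ (pow (m + 4) b) [ d n ]
        | eval-pow-a m | eval-pow-b (m + 4) | xor-identityʳ (not (odd m)) | +-identityʳ (m + 4) = refl

eval-bⁿ⁺¹dₙ : ∀ n → eval (pow (suc n) b ++ [ d n ]) ≡ (a^ false b^ suc n · d′ n)
eval-bⁿ⁺¹dₙ n rewrite eval-++ (pow (suc n) b) [ d n ] | eval-pow-b n | +-identityʳ n = refl

eval-aⁿ⁺¹b²ⁿ⁺⁵ : ∀ n → eval (pow (suc n) a ++ pow (2 * n + 5) b) ≡ (a^ not (odd n) b^ 2 * n + 5 · one)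
eval-aⁿ⁺¹b²ⁿ⁺⁵ n
  rewrite eval-++ (pow (suc n) a) (pow (2 * n + 5) b) | eval-pow-a n | eval-pow-b (2 * n + 5)
        | xor-identityʳ (not (odd n)) = refl

relation⇒≋ : ∀ {l r} → Relation l r → eval l ≋ eval r
relation⇒≋ r-aa         _ = refl
relation⇒≋ r-bc           = bc≋ab³
relation⇒≋ r-cc         _ = refl
relation⇒≋ (r-bd n)       =
  ≋-trans (≡⇒≋ (eval-bⁿ⁺¹dₙ n)) (≋-trans (bⁿ⁺¹dₙ≋aⁿ⁺¹b²ⁿ⁺⁵ n) (≡⇒≋ (sym (eval-aⁿ⁺¹b²ⁿ⁺⁵ n))))
relation⇒≋ (r-cd n)     _ = refl
relation⇒≋ (r-dd m n p)   = ≡⇒≋ (trans (eval-dd m n p) (sym (eval-aᵐ⁺¹bᵐ⁺⁴dₙ m n)))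

≈Q⇒≋ : ∀ {u v} → u ≈Q v → eval u ≋ eval v
≈Q⇒≋ ≈refl              = λ _ → refl
≈Q⇒≋ (≈sym p)           = ≋-sym (≈Q⇒≋ p)
≈Q⇒≋ (≈trans p q)       = ≋-trans (≈Q⇒≋ p) (≈Q⇒≋ q)
≈Q⇒≋ (≈comm xs x y ys)  = ≡⇒≋ (begin
  eval (xs ++ x ∷ y ∷ ys)
    ≡⟨ eval-++ xs (x ∷ y ∷ ys) ⟩
  eval xs ⊗ (genElt x ⊗ (genElt y ⊗ eval ys))
    ≡⟨ cong (eval xs ⊗_) (⊗-swapˡ (genElt x) (genElt y) (eval ys)) ⟩
  eval xs ⊗ (genElt y ⊗ (genElt x ⊗ eval ys))
    ≡⟨ eval-++ xs (y ∷ x ∷ ys) ⟨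
  eval (xs ++ y ∷ x ∷ ys) ∎)
  where open ≡-Reasoning
≈Q⇒≋ (≈rel xs {l} {r} ys l=r) z = begin
  inP (z ⊗ eval (xs ++ l ++ ys))            ≡⟨ cong inP (pull l) ⟩
  inP ((z ⊗ (eval xs ⊗ eval ys)) ⊗ eval l)  ≡⟨ relation⇒≋ l=r (z ⊗ (eval xs ⊗ eval ys)) ⟩
  inP ((z ⊗ (eval xs ⊗ eval ys)) ⊗ eval r)  ≡⟨ cong inP (pull r) ⟨
  inP (z ⊗ eval (xs ++ r ++ ys))            ∎
  where
  open ≡-Reasoning
  pull : ∀ w → z ⊗ eval (xs ++ w ++ ys) ≡ (z ⊗ (eval xs ⊗ eval ys)) ⊗ eval w
  pull w = begin
    z ⊗ eval (xs ++ w ++ ys)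
      ≡⟨ cong (z ⊗_) (trans (eval-++ xs (w ++ ys)) (cong (eval xs ⊗_) (eval-++ w ys))) ⟩
    z ⊗ (eval xs ⊗ (eval w ⊗ eval ys))
      ≡⟨ cong (z ⊗_) (⊗-swapˡ (eval xs) (eval w) (eval ys)) ⟩
    z ⊗ (eval w ⊗ (eval xs ⊗ eval ys))
      ≡⟨ ⊗-swapˡ z (eval w) _ ⟩
    eval w ⊗ (z ⊗ (eval xs ⊗ eval ys))
      ≡⟨ ⊗-comm (eval w) _ ⟩
    (z ⊗ (eval xs ⊗ eval ys)) ⊗ eval w ∎

inP-resp-≈Q : ∀ {u v} → u ≈Q v → inP (eval u) ≡ inP (eval v)
inP-resp-≈Q u≈v = ≈Q⇒≋ u≈v ε

-- Normal forms of words

≡⇒≈Q : ∀ {u v} → u ≡ v → u ≈Q v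
≡⇒≈Q refl = ≈refl

≈Q-∷ : ∀ g {u v} → u ≈Q v → (g ∷ u) ≈Q (g ∷ v)
≈Q-∷ g ≈refl              = ≈refl
≈Q-∷ g (≈sym p)           = ≈sym (≈Q-∷ g p)
≈Q-∷ g (≈trans p q)       = ≈trans (≈Q-∷ g p) (≈Q-∷ g q)
≈Q-∷ g (≈comm xs x y ys)  = ≈comm (g ∷ xs) x y ys
≈Q-∷ g (≈rel xs ys l=r)   = ≈rel (g ∷ xs) ys l=r

≈Q-++ˡ : ∀ w {u v} → u ≈Q v → (w ++ u) ≈Q (w ++ v)
≈Q-++ˡ []      p = p
≈Q-++ˡ (g ∷ w) p = ≈Q-∷ g (≈Q-++ˡ w p)

≈Q-++ʳ : ∀ w {u v} → u ≈Q v → (u ++ w) ≈Q (v ++ w)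
≈Q-++ʳ w ≈refl             = ≈refl
≈Q-++ʳ w (≈sym p)          = ≈sym (≈Q-++ʳ w p)
≈Q-++ʳ w (≈trans p q)      = ≈trans (≈Q-++ʳ w p) (≈Q-++ʳ w q)
≈Q-++ʳ w (≈comm xs x y ys)
  rewrite ++-assoc xs (x ∷ y ∷ ys) w | ++-assoc xs (y ∷ x ∷ ys) w = ≈comm xs x y (ys ++ w)
≈Q-++ʳ w (≈rel xs {l} {r} ys l=r)
  rewrite ++-assoc xs (l ++ ys) w | ++-assoc xs (r ++ ys) w | ++-assoc l ys w | ++-assoc r ys w =
  ≈rel xs (ys ++ w) l=r

word-commutativeMonoid : CommutativeMonoid _ _
word-commutativeMonoid = record
  { Carrier = Word
  ; _≈_ = _≈Q_
  ; _∙_ = _++_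
  ; ε = []
  ; isCommutativeMonoid = record
    { isMonoid = record
      { isSemigroup = record
        { isMagma = record
          { isEquivalence = record { refl = ≈refl ; sym = ≈sym ; trans = ≈trans }
          ; ∙-cong = λ {u} {u′} {v} p q → ≈trans (≈Q-++ʳ v p) (≈Q-++ˡ u′ q)
          }
        ; assoc = λ u v w → ≡⇒≈Q (++-assoc u v w)
        }
      ; identity = (λ _ → ≈refl) , (λ u → ≡⇒≈Q (++-identityʳ u))
      }
    ; comm = ++-comm-≈Q
    }
  }
  where
  ++-comm-≈Q : ∀ u v → (u ++ v) ≈Q (v ++ u)
  ++-comm-≈Q []      v = ≡⇒≈Q (sym (++-identityʳ v))
  ++-comm-≈Q (g ∷ u) v = ≈trans (≈Q-∷ g (++-comm-≈Q u v)) (g∷-comm v)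
    where
    g∷-comm : ∀ v → (g ∷ v ++ u) ≈Q (v ++ g ∷ u)
    g∷-comm []      = ≈refl
    g∷-comm (x ∷ v) = ≈trans (≈comm [] g x (v ++ u)) (≈Q-∷ x (g∷-comm v))

module _ where
  open Algebra.Solver.CommutativeMonoid word-commutativeMonoid using (solve; _⊕_; _⊜_; id)
  open import Relation.Binary.Reasoning.Setoid (CommutativeMonoid.setoid word-commutativeMonoid)

  optA : Bool → Word
  optA false = []
  optA true  = [ a ]

  -- The d-index is written j + k, which builds in the constraint j ≤ n of a normal form a^i b^j d_n.
  data Normal : Set where
    plain : Bool → ℕ → Normal
    withC : Bool → Normal
    withD : Bool → ℕ → ℕ → Normal

  toWord : Normal → Word
  toWord (plain i j)   = optA i ++ pow j b
  toWord (withC i)     = optA i ++ [ c ]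
  toWord (withD i j k) = optA i ++ pow j b ++ [ d (j + k) ]

  HasNormalForm : Word → Set
  HasNormalForm w = Σ Normal λ y → w ≈Q toWord y

  hasNormalForm-resp : ∀ {u v} → u ≈Q v → HasNormalForm v → HasNormalForm u
  hasNormalForm-resp u≈v (y , v≈y) = y , ≈trans u≈v v≈y

  cancel-a : ∀ i w → (a ∷ optA i ++ w) ≈Q (optA (not i) ++ w)
  cancel-a false w = ≈refl
  cancel-a true  w = ≈rel [] w r-aa

  absorb-pow : ∀ {g} → (∀ x → HasNormalForm (g ∷ toWord x)) → ∀ k x → HasNormalForm (pow k g ++ toWord x)
  absorb-pow absorb zero    x = x , ≈refl
  absorb-pow {g} absorb (suc k) x with absorb-pow absorb k x
  ... | y , p = hasNormalForm-resp (≈Q-∷ g p) (absorb y)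

  absorb-a : ∀ x → HasNormalForm (a ∷ toWord x)
  absorb-a (plain i j)   = plain (not i) j , cancel-a i _
  absorb-a (withC i)     = withC (not i) , cancel-a i _
  absorb-a (withD i j k) = withD (not i) j k , cancel-a i _

  absorb-b : ∀ x → HasNormalForm (b ∷ toWord x)
  absorb-b (plain i j) =
    plain i (suc j) , solve 3 (λ β A B → β ⊕ (A ⊕ B) ⊜ A ⊕ (β ⊕ B)) ≈refl [ b ] (optA i) (pow j b)
  absorb-b (withC i) = plain (not i) 3 , (begin
    b ∷ optA i ++ [ c ]     ≈⟨ solve 3 (λ β A γ → β ⊕ (A ⊕ γ) ⊜ (β ⊕ γ) ⊕ A) ≈refl [ b ] (optA i) [ c ] ⟩
    (b ∷ c ∷ []) ++ optA i  ≈⟨ ≈rel [] (optA i) r-bc ⟩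
    a ∷ pow 3 b ++ optA i   ≈⟨ ≈Q-∷ a (solve 2 (λ B A → B ⊕ A ⊜ A ⊕ B) ≈refl (pow 3 b) (optA i)) ⟩
    a ∷ optA i ++ pow 3 b   ≈⟨ cancel-a i _ ⟩
    toWord (plain (not i) 3) ∎)
  absorb-b (withD i j (suc k)) = withD i (suc j) k , (begin
    b ∷ optA i ++ pow j b ++ [ d (j + suc k) ]
      ≈⟨ solve 4 (λ β A B δ → β ⊕ (A ⊕ (B ⊕ δ)) ⊜ A ⊕ (β ⊕ (B ⊕ δ))) ≈refl [ b ] (optA i) (pow j b) [ d (j + suc k) ] ⟩
    optA i ++ b ∷ pow j b ++ [ d (j + suc k) ]
      ≡⟨ cong (λ n → optA i ++ b ∷ pow j b ++ [ d n ]) (+-suc j k) ⟩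
    toWord (withD i (suc j) k) ∎)
  absorb-b (withD i j zero) = hasNormalForm-resp (begin
    b ∷ optA i ++ pow j b ++ [ d (j + 0) ]
      ≡⟨ cong (λ n → b ∷ optA i ++ pow j b ++ [ d n ]) (+-identityʳ j) ⟩
    b ∷ optA i ++ pow j b ++ [ d j ]
      ≈⟨ solve 4 (λ β A B δ → β ⊕ (A ⊕ (B ⊕ δ)) ⊜ ((β ⊕ B) ⊕ δ) ⊕ A) ≈refl [ b ] (optA i) (pow j b) [ d j ] ⟩
    (pow (suc j) b ++ [ d j ]) ++ optA i
      ≈⟨ ≈rel [] (optA i) (r-bd j) ⟩
    (pow (suc j) a ++ pow (2 * j + 5) b) ++ optA i
      ≈⟨ solve 3 (λ α B A → (α ⊕ B) ⊕ A ⊜ α ⊕ (A ⊕ B)) ≈refl (pow (suc j) a) (pow (2 * j + 5) b) (optA i) ⟩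
    pow (suc j) a ++ toWord (plain i (2 * j + 5)) ∎)
    (absorb-pow absorb-a (suc j) (plain i (2 * j + 5)))

  absorb-aᵐbᵏ : ∀ m k x → HasNormalForm (pow m a ++ pow k b ++ toWord x)
  absorb-aᵐbᵏ m k x with absorb-pow absorb-b k x
  ... | y , p = hasNormalForm-resp (≈Q-++ˡ (pow m a) p) (absorb-pow absorb-a m y)

  absorb-c : ∀ x → HasNormalForm (c ∷ toWord x)
  absorb-c (plain i zero) =
    withC i , solve 2 (λ γ A → γ ⊕ (A ⊕ id) ⊜ A ⊕ γ) ≈refl [ c ] (optA i)
  absorb-c (plain i (suc j)) = plain (not i) (3 + j) , (begin
    c ∷ optA i ++ b ∷ pow j b
      ≈⟨ solve 4 (λ γ A β B → γ ⊕ (A ⊕ (β ⊕ B)) ⊜ (β ⊕ γ) ⊕ (A ⊕ B)) ≈refl [ c ] (optA i) [ b ] (pow j b) ⟩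
    (b ∷ c ∷ []) ++ optA i ++ pow j b
      ≈⟨ ≈rel [] (optA i ++ pow j b) r-bc ⟩
    a ∷ pow 3 b ++ optA i ++ pow j b
      ≈⟨ ≈Q-∷ a (solve 3 (λ B A B′ → B ⊕ (A ⊕ B′) ⊜ A ⊕ (B ⊕ B′)) ≈refl (pow 3 b) (optA i) (pow j b)) ⟩
    a ∷ optA i ++ pow (3 + j) b
      ≈⟨ cancel-a i _ ⟩
    toWord (plain (not i) (3 + j)) ∎)
  absorb-c (withC i) = plain i 4 , (begin
    c ∷ optA i ++ [ c ]      ≈⟨ solve 2 (λ γ A → γ ⊕ (A ⊕ γ) ⊜ (γ ⊕ γ) ⊕ A) ≈refl [ c ] (optA i) ⟩
    (c ∷ c ∷ []) ++ optA i   ≈⟨ ≈rel [] (optA i) r-cc ⟩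
    pow 4 b ++ optA i        ≈⟨ solve 2 (λ B A → B ⊕ A ⊜ A ⊕ B) ≈refl (pow 4 b) (optA i) ⟩
    toWord (plain i 4)       ∎)
  absorb-c (withD i j k) = hasNormalForm-resp (begin
    c ∷ optA i ++ pow j b ++ [ d n ]
      ≈⟨ solve 4 (λ γ A B δ → γ ⊕ (A ⊕ (B ⊕ δ)) ⊜ (γ ⊕ δ) ⊕ (A ⊕ B)) ≈refl [ c ] (optA i) (pow j b) [ d n ] ⟩
    (c ∷ d n ∷ []) ++ optA i ++ pow j b
      ≈⟨ ≈rel [] (optA i ++ pow j b) (r-cd n) ⟩
    (a ∷ b ∷ b ∷ d n ∷ []) ++ optA i ++ pow j b
      ≈⟨ solve 5 (λ α β β′ δ R → (α ⊕ (β ⊕ (β′ ⊕ δ))) ⊕ R ⊜ α ⊕ (β ⊕ (β′ ⊕ (δ ⊕ R)))) ≈refl [ a ] [ b ] [ b ] [ d n ] (optA i ++ pow j b) ⟩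
    a ∷ b ∷ b ∷ d n ∷ optA i ++ pow j b
      ≈⟨ ≈Q-++ˡ (a ∷ b ∷ b ∷ []) (solve 3 (λ δ A B → δ ⊕ (A ⊕ B) ⊜ A ⊕ (B ⊕ δ)) ≈refl [ d n ] (optA i) (pow j b)) ⟩
    pow 1 a ++ pow 2 b ++ toWord (withD i j k) ∎)
    (absorb-aᵐbᵏ 1 2 (withD i j k))
    where n = j + k

  absorb-d : ∀ m x → HasNormalForm (d m ∷ toWord x)
  absorb-d m (plain i j) = hasNormalForm-resp
    (solve 3 (λ δ A B → δ ⊕ (A ⊕ B) ⊜ B ⊕ (A ⊕ δ)) ≈refl [ d m ] (optA i) (pow j b))
    (absorb-pow absorb-b j (withD i 0 m))
  absorb-d m (withC i) = hasNormalForm-resp (begin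
    d m ∷ optA i ++ [ c ]
      ≈⟨ solve 3 (λ δ A γ → δ ⊕ (A ⊕ γ) ⊜ (γ ⊕ δ) ⊕ A) ≈refl [ d m ] (optA i) [ c ] ⟩
    (c ∷ d m ∷ []) ++ optA i
      ≈⟨ ≈rel [] (optA i) (r-cd m) ⟩
    (a ∷ b ∷ b ∷ d m ∷ []) ++ optA i
      ≈⟨ ≈Q-++ˡ (a ∷ b ∷ b ∷ []) (solve 2 (λ δ A → δ ⊕ A ⊜ A ⊕ δ) ≈refl [ d m ] (optA i)) ⟩
    pow 1 a ++ pow 2 b ++ toWord (withD i 0 m) ∎)
    (absorb-aᵐbᵏ 1 2 (withD i 0 m))
  absorb-d m (withD i j k) with ≤-total m (j + k)
  ... | inj₁ m≤n = hasNormalForm-resp (begin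
    d m ∷ optA i ++ pow j b ++ [ d n ]
      ≈⟨ solve 4 (λ δ A B δ′ → δ ⊕ (A ⊕ (B ⊕ δ′)) ⊜ (δ ⊕ δ′) ⊕ (A ⊕ B)) ≈refl [ d m ] (optA i) (pow j b) [ d n ] ⟩
    (d m ∷ d n ∷ []) ++ optA i ++ pow j b
      ≈⟨ ≈rel [] (optA i ++ pow j b) (r-dd m n m≤n) ⟩
    (pow (suc m) a ++ pow (m + 4) b ++ [ d n ]) ++ optA i ++ pow j b
      ≈⟨ solve 5 (λ α β δ A B → (α ⊕ (β ⊕ δ)) ⊕ (A ⊕ B) ⊜ α ⊕ (β ⊕ (A ⊕ (B ⊕ δ)))) ≈refl (pow (suc m) a) (pow (m + 4) b) [ d n ] (optA i) (pow j b) ⟩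
    pow (suc m) a ++ pow (m + 4) b ++ toWord (withD i j k) ∎)
    (absorb-aᵐbᵏ (suc m) (m + 4) (withD i j k))
    where n = j + k
  ... | inj₂ n≤m with absorb-pow absorb-b j (withD i 0 m)
  ...   | y , p = hasNormalForm-resp (begin
    d m ∷ optA i ++ pow j b ++ [ d n ]
      ≈⟨ solve 4 (λ δ A B δ′ → δ ⊕ (A ⊕ (B ⊕ δ′)) ⊜ (δ′ ⊕ δ) ⊕ (A ⊕ B)) ≈refl [ d m ] (optA i) (pow j b) [ d n ] ⟩
    (d n ∷ d m ∷ []) ++ optA i ++ pow j b
      ≈⟨ ≈rel [] (optA i ++ pow j b) (r-dd n m n≤m) ⟩
    (pow (suc n) a ++ pow (n + 4) b ++ [ d m ]) ++ optA i ++ pow j b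
      ≈⟨ solve 5 (λ α β δ A B → (α ⊕ (β ⊕ δ)) ⊕ (A ⊕ B) ⊜ α ⊕ (β ⊕ (B ⊕ (A ⊕ δ)))) ≈refl (pow (suc n) a) (pow (n + 4) b) [ d m ] (optA i) (pow j b) ⟩
    pow (suc n) a ++ pow (n + 4) b ++ pow j b ++ toWord (withD i 0 m)
      ≈⟨ ≈Q-++ˡ (pow (suc n) a) (≈Q-++ˡ (pow (n + 4) b) p) ⟩
    pow (suc n) a ++ pow (n + 4) b ++ toWord y ∎)
    (absorb-aᵐbᵏ (suc n) (n + 4) y)
    where n = j + k

  absorb : ∀ g x → HasNormalForm (g ∷ toWord x)
  absorb a     = absorb-a
  absorb b     = absorb-b
  absorb c     = absorb-c
  absorb (d m) = absorb-d m

  normalise : ∀ w → HasNormalForm w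
  normalise []      = plain false 0 , ≈refl
  normalise (g ∷ w) with normalise w
  ... | y , p = hasNormalForm-resp (≈Q-∷ g p) (absorb g y)

odd-double : ∀ k → odd (2 * k) ≡ false
odd-double k rewrite odd-+ k (k + 0) | +-identityʳ k = xor-same (odd k)

even⇒odd≡false : ∀ {n} → Even n → odd n ≡ false
even⇒odd≡false (k , refl) = odd-double k

odd⇒odd≡true : ∀ {n} → Odd n → odd n ≡ true
odd⇒odd≡true (k , refl) = cong not (odd-double k)

not≡false⇒≡true : ∀ {x} → not x ≡ false → x ≡ true
not≡false⇒≡true {true} _ = refl

not≡true⇒≡false : ∀ {x} → not x ≡ true → x ≡ false
not≡true⇒≡false {false} _ = refl

mutual
  odd≡false⇒even : ∀ n → odd n ≡ false → Even n
  odd≡false⇒even zero    _ = 0 , refl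
  odd≡false⇒even (suc n) h with odd≡true⇒odd n (not≡false⇒≡true h)
  ... | k , refl = suc k , cong suc (sym (+-suc k (k + 0)))

  odd≡true⇒odd : ∀ n → odd n ≡ true → Odd n
  odd≡true⇒odd (suc n) h with odd≡false⇒even n (trans (sym (not-involutive _)) (cong not h))
  ... | k , refl = k , refl

eval-optA : ∀ i w → eval (optA i ++ w) ≡ (a^ i xor aBit (eval w) b^ bExp (eval w) · tailOf (eval w))
eval-optA false w = refl
eval-optA true  w = refl

eval-plain : ∀ i j → eval (optA i ++ pow j b) ≡ (a^ i b^ j · one)
eval-plain i j rewrite eval-optA i (pow j b) | eval-pow-b j | xor-identityʳ i = refl

eval-withC : ∀ i → eval (optA i ++ [ c ]) ≡ (a^ i b^ 0 · c′)
eval-withC i rewrite eval-optA i [ c ] | xor-identityʳ i = refl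

eval-withD : ∀ i j n → eval (optA i ++ pow j b ++ [ d n ]) ≡ (a^ i b^ j · d′ n)
eval-withD i j n
  rewrite eval-optA i (pow j b ++ [ d n ]) | eval-++ (pow j b) [ d n ] | eval-pow-b j
        | xor-identityʳ i | +-identityʳ j = refl

sameBit⇒≡ : ∀ {x y} → sameBit x y ≡ true → x ≡ y
sameBit⇒≡ {true}  {true}  _ = refl
sameBit⇒≡ {false} {false} _ = refl

∧≡true : ∀ {x y} → (x ∧ y) ≡ true → x ≡ true × y ≡ true
∧≡true {true} {true} _ = refl , refl

plainInP⇒PWord : ∀ i j → plainInP i j ≡ true → PWord (optA i ++ pow j b)
plainInP⇒PWord true  zero          _ = p-a
plainInP⇒PWord false (suc (suc j)) h with odd≡false⇒even j (not≡true⇒≡false h)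
... | k , refl = subst (λ n → PWord (pow n b)) (cong suc (+-suc k (k + 0))) (p-b (suc k) (s≤s z≤n))

withDInP⇒PWord : ∀ i j n → j < n → i ≡ odd n → odd j ≡ not (odd n) → PWord (optA i ++ pow j b ++ [ d n ])
withDInP⇒PWord _ j n j<n refl oj with odd n in on
... | false = p-d j n (odd≡true⇒odd j oj) (odd≡false⇒even n on) j<n
... | true  = p-ad j n (odd≡false⇒even j oj) (odd≡true⇒odd n on) j<n

inP⇒PWord : ∀ y → inP (eval (toWord y)) ≡ true → PWord (toWord y)
inP⇒PWord (plain i j) h rewrite eval-plain i j = plainInP⇒PWord i j h
inP⇒PWord (withC i) h rewrite eval-withC i with h
... | ()
inP⇒PWord (withD i j zero) h rewrite eval-withD i j (j + 0) | +-identityʳ j | dInP-≡ i j with h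
... | ()
inP⇒PWord (withD i j (suc k)) h rewrite eval-withD i j (j + suc k) | dInP-< i (m<m+n j (s≤s (z≤n {k}))) with ∧≡true h
... | h₁ , h₂ = withDInP⇒PWord i j (j + suc k) (m<m+n j (s≤s z≤n)) (sameBit⇒≡ h₁) (sameBit⇒≡ h₂)

PWord⇒inP : ∀ {p} → PWord p → inP (eval p) ≡ true
PWord⇒inP p-a = refl
PWord⇒inP (p-b (suc m) _) rewrite eval-pow-b (2 * suc m) | +-suc m (m + 0) = cong not (odd-double m)
PWord⇒inP (p-d m n om en m<n)
  rewrite eval-withD false m n | dInP-< false m<n | even⇒odd≡false en | odd⇒odd≡true om = refl
PWord⇒inP (p-ad m n em on m<n)
  rewrite eval-withD true m n | dInP-< true m<n | even⇒odd≡false em | odd⇒odd≡true on = refl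

inP⇒∈𝒫 : ∀ w → inP (eval w) ≡ true → w ∈𝒫
inP⇒∈𝒫 w h with normalise w
... | y , w≈y = toWord y , inP⇒PWord y (trans (sym (inP-resp-≈Q w≈y)) h) , w≈y

∈𝒫⇒inP : ∀ w → w ∈𝒫 → inP (eval w) ≡ true
∈𝒫⇒inP w (p , p∈𝒫 , w≈p) = trans (inP-resp-≈Q w≈p) (PWord⇒inP p∈𝒫)

x≢not-x : ∀ {x} → x ≢ not x
x≢not-x {true}  ()
x≢not-x {false} ()

plainInP-cases : ∀ {i j} → plainInP i j ≡ true →
                 (i ≡ true × j ≡ 0) ⊎ (i ≡ false × Σ ℕ λ j′ → j ≡ suc (suc j′) × odd j′ ≡ false)
plainInP-cases {true}  {zero}        _ = inj₁ (refl , refl)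
plainInP-cases {false} {suc (suc j)} h = inj₂ (refl , j , refl , not≡true⇒≡false h)

odd-+4 : ∀ m → odd (m + 4) ≡ odd m
odd-+4 m rewrite odd-+ m 4 = xor-identityʳ (odd m)

plainInP-+4 : ∀ x m → plainInP x (m + 4) ≡ (not x ∧ not (odd m))
plainInP-+4 x m rewrite +-comm m 4 with x
... | true  = refl
... | false = cong not (not-involutive (odd m))

data InPWithD (i : Bool) (j n : ℕ) : Set where
  below : j < n → i ≡ odd n → odd j ≡ not (odd n) → InPWithD i j n
  above : n < j → i ≡ not (odd n) → odd j ≡ odd n → InPWithD i j n

dInP⇒InPWithD : ∀ {i j n} → dInP i j n ≡ true → InPWithD i j n
dInP⇒InPWithD {i} {j} {n} h with <-cmp j n
... | tri< j<n _ _ rewrite dInP-< i j<n with ∧≡true h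
...   | h₁ , h₂ = below j<n (sameBit⇒≡ h₁) (sameBit⇒≡ h₂)
dInP⇒InPWithD {i} {j} h | tri≈ _ refl _ rewrite dInP-≡ i j with h
... | ()
dInP⇒InPWithD {i} {j} {n} h | tri> _ _ n<j
  rewrite dInP-> i n<j | plainInP-+4 (i xor not (odd n)) (j + n) | odd-+ j n with ∧≡true h
... | h₁ , h₂ = above n<j (sameBit⇒≡ h₁) (sameBit⇒≡ h₂)

InPWithD⇒dInP : ∀ {i j n} → InPWithD i j n → dInP i j n ≡ true
InPWithD⇒dInP {i} {j} {n} (below j<n refl oj) rewrite dInP-< i j<n | oj with odd n
... | true  = refl
... | false = refl
InPWithD⇒dInP {i} {j} {n} (above n<j refl oj)
  rewrite dInP-> i n<j | plainInP-+4 (i xor not (odd n)) (j + n) | odd-+ j n | oj with odd n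
... | true  = refl
... | false = refl

dInP-b-exclusive : ∀ i j n → dInP i (suc j) n ≡ true → dInP (not i) j n ≡ false
dInP-b-exclusive i j n h = ¬-not λ h′ → exclusive (dInP⇒InPWithD h) (dInP⇒InPWithD h′)
  where
  exclusive : InPWithD i (suc j) n → InPWithD (not i) j n → ⊥
  exclusive (below _ e _)   (below _ e′ _)  = x≢not-x (trans e (sym e′))
  exclusive (below j<n _ _) (above n<j _ _) = <-asym j<n (m<n⇒m<1+n n<j)
  exclusive (above n<j _ _) (below j<n _ _) = <-irrefl refl (<-≤-trans j<n (≤-pred n<j))
  exclusive (above _ e _)   (above _ e′ _)  = x≢not-x (trans e (sym e′))

dInP-d-exclusive : ∀ i j n → dInP i j (suc n) ≡ true → dInP i j n ≡ false
dInP-d-exclusive i j n h = ¬-not λ h′ → exclusive (dInP⇒InPWithD h) (dInP⇒InPWithD h′)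
  where
  exclusive : InPWithD i j (suc n) → InPWithD i j n → ⊥
  exclusive (below _ e _)   (below _ e′ _)  = x≢not-x (trans (sym e′) e)
  exclusive (below j<n _ _) (above n<j _ _) = <-irrefl refl (<-≤-trans n<j (≤-pred j<n))
  exclusive (above n<j _ _) (below j<n _ _) = <-asym j<n (<-trans (n<1+n n) n<j)
  exclusive (above _ e _)   (above _ e′ _)  = x≢not-x (trans (sym e′) e)

tailParity : Tail → Bool
tailParity one    = false
tailParity c′     = true
tailParity (d′ _) = true

-- Every generator has odd length and every defining relation of Q preserves the parity of length.
lengthParity : Elt → Bool
lengthParity (a^ i b^ j · t) = i xor (odd j xor tailParity t)

⋆-lengthParity : ∀ s t → lengthParity (s ⋆ t) ≡ tailParity s xor tailParity t
⋆-lengthParity one    _      = refl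
⋆-lengthParity c′     one    = refl
⋆-lengthParity c′     c′     = refl
⋆-lengthParity c′     (d′ _) = refl
⋆-lengthParity (d′ _) one    = refl
⋆-lengthParity (d′ _) c′     = refl
⋆-lengthParity (d′ n) (d′ m) rewrite odd-+4 (n ⊓ m) with odd (n ⊓ m)
... | true  = refl
... | false = refl

lengthParity-⊗ : ∀ x y → lengthParity (x ⊗ y) ≡ lengthParity x xor lengthParity y
lengthParity-⊗ (a^ i b^ j · s) (a^ i′ b^ j′ · t) rewrite odd-+ (bExp (s ⋆ t)) (j + j′) | odd-+ j j′ = begin
  (e xor (i xor i′)) xor ((f xor (odd j xor odd j′)) xor u)
    ≡⟨ solve 7 (λ e f u i i′ j j′ → (e ⊕ (i ⊕ i′)) ⊕ ((f ⊕ (j ⊕ j′)) ⊕ u) ⊜ (e ⊕ (f ⊕ u)) ⊕ ((i ⊕ j) ⊕ (i′ ⊕ j′)))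
              refl e f u i i′ (odd j) (odd j′) ⟩
  (e xor (f xor u)) xor ((i xor odd j) xor (i′ xor odd j′))
    ≡⟨ cong (_xor ((i xor odd j) xor (i′ xor odd j′))) (⋆-lengthParity s t) ⟩
  (tailParity s xor tailParity t) xor ((i xor odd j) xor (i′ xor odd j′))
    ≡⟨ solve 6 (λ σ τ i i′ j j′ → (σ ⊕ τ) ⊕ ((i ⊕ j) ⊕ (i′ ⊕ j′)) ⊜ (i ⊕ (j ⊕ σ)) ⊕ (i′ ⊕ (j′ ⊕ τ)))
              refl (tailParity s) (tailParity t) i i′ (odd j) (odd j′) ⟩
  (i xor (odd j xor tailParity s)) xor (i′ xor (odd j′ xor tailParity t)) ∎
  where
  open ≡-Reasoning
  open XorSolver using (solve; _⊕_; _⊜_)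
  e = aBit (s ⋆ t)
  f = odd (bExp (s ⋆ t))
  u = tailParity (tailOf (s ⋆ t))

a-elt : Elt
a-elt = a^ true b^ 0 · one

inP⇒evenLength⊎a : ∀ x → inP x ≡ true → lengthParity x ≡ false ⊎ x ≡ a-elt
inP⇒evenLength⊎a (a^ i b^ j · one) h with plainInP-cases {i} {j} h
... | inj₁ (refl , refl)          = inj₂ refl
... | inj₂ (refl , j′ , refl , o) = inj₁ (trans (xor-identityʳ _) (trans (not-involutive _) o))
inP⇒evenLength⊎a (a^ i b^ suc j · c′) h with plainInP-cases {not i} {3 + j} h
... | inj₂ (ni , _ , refl , o) rewrite not≡false⇒≡true ni | not≡false⇒≡true o = inj₁ refl
inP⇒evenLength⊎a (a^ i b^ j · d′ n) h with dInP⇒InPWithD {i} {j} {n} h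
... | below _ refl oj rewrite oj with odd n
...   | true  = inj₁ refl
...   | false = inj₁ refl
inP⇒evenLength⊎a (a^ i b^ j · d′ n) h | above _ refl oj rewrite oj with odd n
...   | true  = inj₁ refl
...   | false = inj₁ refl

-- No move between positions with value in 𝒫

exclusive-sym : ∀ {x y} → (x ≡ true → y ≡ false) → y ≡ true → x ≡ false
exclusive-sym {false} _ _ = refl
exclusive-sym {true}  f y≡true with trans (sym y≡true) (f refl)
... | ()

heapValue : ℕ → Elt
heapValue k = eval (φ k)

value : Position → Elt
value []      = ε
value (k ∷ G) = heapValue k ⊗ value G

value≡evalΦ : ∀ G → value G ≡ eval (Φ G)
value≡evalΦ []      = refl
value≡evalΦ (k ∷ G) rewrite value≡evalΦ G = sym (eval-++ (φ k) (Φ G))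

lengthParity-heap : ∀ k → lengthParity (heapValue (suc k)) ≡ true
lengthParity-heap 0 = refl
lengthParity-heap 1 = refl
lengthParity-heap 2 = refl
lengthParity-heap 3 = refl
lengthParity-heap 4 = refl
lengthParity-heap 5 = refl
lengthParity-heap (suc (suc (suc (suc (suc (suc _)))))) = refl

inP-lengthParity-change : ∀ h o z → lengthParity h ≡ true → lengthParity o ≡ false →
                          inP (h ⊗ z) ≡ true → inP (o ⊗ z) ≡ true → h ⊗ z ≡ a-elt ⊎ o ⊗ z ≡ a-elt
inP-lengthParity-change h o z lp-h lp-o hz∈P oz∈P
  with inP⇒evenLength⊎a (h ⊗ z) hz∈P | inP⇒evenLength⊎a (o ⊗ z) oz∈P
... | inj₂ e  | _       = inj₁ e
... | inj₁ _  | inj₂ e  = inj₂ e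
... | inj₁ e₁ | inj₁ e₂ = ⊥-elim (x≢not-x (trans z-even (sym z-odd)))
  where
  z-odd : not (lengthParity z) ≡ false
  z-odd = trans (cong (_xor lengthParity z) (sym lp-h)) (trans (sym (lengthParity-⊗ h z)) e₁)
  z-even : lengthParity z ≡ false
  z-even = trans (cong (_xor lengthParity z) (sym lp-o)) (trans (sym (lengthParity-⊗ o z)) e₂)

IsAPower : Elt → Set
IsAPower x = tailOf x ≡ one × bExp x ≡ 0

⊗-isAPower⁻ : ∀ x y → IsAPower (x ⊗ y) → IsAPower x × IsAPower y
⊗-isAPower⁻ (a^ _ b^ 0     · one)  (a^ _ b^ 0     · one)  _        = (refl , refl) , (refl , refl)
⊗-isAPower⁻ (a^ _ b^ suc _ · one)  (a^ _ b^ _     · one)  (_ , ())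
⊗-isAPower⁻ (a^ _ b^ 0     · one)  (a^ _ b^ suc _ · one)  (_ , ())
⊗-isAPower⁻ (a^ _ b^ _     · one)  (a^ _ b^ _     · c′)   (() , _)
⊗-isAPower⁻ (a^ _ b^ _     · one)  (a^ _ b^ _     · d′ _) (() , _)
⊗-isAPower⁻ (a^ _ b^ _     · c′)   (a^ _ b^ _     · one)  (() , _)
⊗-isAPower⁻ (a^ _ b^ _     · c′)   (a^ _ b^ _     · c′)   (_ , ())
⊗-isAPower⁻ (a^ _ b^ _     · c′)   (a^ _ b^ _     · d′ _) (() , _)
⊗-isAPower⁻ (a^ _ b^ _     · d′ _) (a^ _ b^ _     · one)  (() , _)
⊗-isAPower⁻ (a^ _ b^ _     · d′ _) (a^ _ b^ _     · c′)   (() , _)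
⊗-isAPower⁻ (a^ _ b^ _     · d′ _) (a^ _ b^ _     · d′ _) (() , _)

⊗≡a⁻ : ∀ x y → x ⊗ y ≡ a-elt → IsAPower x × IsAPower y × aBit x xor aBit y ≡ true
⊗≡a⁻ (a^ i b^ j · s) (a^ i′ b^ j′ · t) e with ⊗-isAPower⁻ (a^ i b^ j · s) (a^ i′ b^ j′ · t) (cong tailOf e , cong bExp e)
... | (refl , refl) , (refl , refl) = (refl , refl) , (refl , refl) , cong aBit e

isAPower-η : ∀ z {β} → IsAPower z → aBit z ≡ β → z ≡ (a^ β b^ 0 · one)
isAPower-η (a^ _ b^ _ · _) (refl , refl) refl = refl

isAPower-heapSize : ∀ u → IsAPower (heapValue u) → u ≡ 0 ⊎ u ≡ 1 ⊎ u ≡ 3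
isAPower-heapSize 0 _ = inj₁ refl
isAPower-heapSize 1 _ = inj₂ (inj₁ refl)
isAPower-heapSize 3 _ = inj₂ (inj₂ refl)
isAPower-heapSize 2 (_ , ())
isAPower-heapSize 4 (_ , ())
isAPower-heapSize 5 (() , _)
isAPower-heapSize 6 (_ , ())
isAPower-heapSize (suc (suc (suc (suc (suc (suc (suc _))))))) (() , _)

heap⊗z≡a : ∀ k z → heapValue k ⊗ z ≡ a-elt → 2 ≤ k → k ≡ 3 × z ≡ ε
heap⊗z≡a k z e 2≤k with ⊗≡a⁻ (heapValue k) z e
... | k-pure , z-pure , bits with isAPower-heapSize k k-pure
...   | inj₁ refl        = ⊥-elim (1+n≰n (≤-trans (s≤s z≤n) 2≤k))
...   | inj₂ (inj₁ refl) = ⊥-elim (1+n≰n 2≤k)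
...   | inj₂ (inj₂ refl) = refl , isAPower-η z z-pure (not≡true⇒≡false bits)

IsAHeap : ℕ → Set
IsAHeap k = k ≡ 1 ⊎ k ≡ 3

pair⊗z≡a : ∀ u v z → value (suc u ∷ suc v ∷ []) ⊗ z ≡ a-elt → IsAHeap (suc u) × IsAHeap (suc v) × z ≡ a-elt
pair⊗z≡a u v z e with ⊗≡a⁻ (value (suc u ∷ suc v ∷ [])) z e
... | pair-pure , z-pure , bits with ⊗-isAPower⁻ (heapValue (suc u)) (heapValue (suc v) ⊗ ε) pair-pure
...   | u-pure , v⊗ε-pure with ⊗-isAPower⁻ (heapValue (suc v)) ε v⊗ε-pure
...     | v-pure , _ with isAPower-heapSize (suc u) u-pure | isAPower-heapSize (suc v) v-pure
... | inj₂ (inj₁ refl) | inj₂ (inj₁ refl) = inj₁ refl , inj₁ refl , isAPower-η z z-pure bits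
... | inj₂ (inj₁ refl) | inj₂ (inj₂ refl) = inj₁ refl , inj₂ refl , isAPower-η z z-pure bits
... | inj₂ (inj₂ refl) | inj₂ (inj₁ refl) = inj₂ refl , inj₁ refl , isAPower-η z z-pure bits
... | inj₂ (inj₂ refl) | inj₂ (inj₂ refl) = inj₂ refl , inj₂ refl , isAPower-η z z-pure bits

TwoHeapOption : ℕ → ℕ → ℕ → Set
TwoHeapOption k u v = k ≡ suc u + suc v ⊎ k ≡ suc (suc u + suc v)

twoHeapOption-2≤ : ∀ {k u v} → TwoHeapOption k u v → 2 ≤ k
twoHeapOption-2≤ {u = u} {v} (inj₁ refl) = s≤s (≤-trans (s≤s z≤n) (m≤n+m (suc v) u))
twoHeapOption-2≤ (inj₂ refl) = s≤s (s≤s z≤n)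

twoHeapOption-lengthParity : ∀ {k u v} → TwoHeapOption k u v → lengthParity (heapValue k) ≡ true
twoHeapOption-lengthParity {u = u} {v} (inj₁ refl) = lengthParity-heap (u + suc v)
twoHeapOption-lengthParity {u = u} {v} (inj₂ refl) = lengthParity-heap (suc (u + suc v))

lengthParity-pair : ∀ u v → lengthParity (value (suc u ∷ suc v ∷ [])) ≡ false
lengthParity-pair u v
  rewrite lengthParity-⊗ (heapValue (suc u)) (heapValue (suc v) ⊗ ε) | lengthParity-⊗ (heapValue (suc v)) ε
        | lengthParity-heap u | lengthParity-heap v = refl

twoHeapOptions-of-3 : ∀ u v → TwoHeapOption 3 u v → inP (value (suc u ∷ suc v ∷ []) ⊗ ε) ≡ false
twoHeapOptions-of-3 0 1 (inj₁ refl) = refl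
twoHeapOptions-of-3 1 0 (inj₁ refl) = refl
twoHeapOptions-of-3 0 0 (inj₂ refl) = refl
twoHeapOptions-of-3 0 0 (inj₁ ())
twoHeapOptions-of-3 0 (suc (suc _)) (inj₁ ())
twoHeapOptions-of-3 (suc zero) (suc _) (inj₁ ())
twoHeapOptions-of-3 (suc (suc zero)) _ (inj₁ ())
twoHeapOptions-of-3 (suc (suc (suc _))) _ (inj₁ ())
twoHeapOptions-of-3 0 (suc _) (inj₂ ())
twoHeapOptions-of-3 (suc zero) _ (inj₂ ())
twoHeapOptions-of-3 (suc (suc _)) _ (inj₂ ())

heap⊗a-for-aPairs : ∀ k u v → TwoHeapOption k u v → IsAHeap (suc u) → IsAHeap (suc v) → inP (heapValue k ⊗ a-elt) ≡ false
heap⊗a-for-aPairs _ _ _ (inj₁ refl) (inj₁ refl) (inj₁ refl) = refl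
heap⊗a-for-aPairs _ _ _ (inj₁ refl) (inj₁ refl) (inj₂ refl) = refl
heap⊗a-for-aPairs _ _ _ (inj₁ refl) (inj₂ refl) (inj₁ refl) = refl
heap⊗a-for-aPairs _ _ _ (inj₁ refl) (inj₂ refl) (inj₂ refl) = refl
heap⊗a-for-aPairs _ _ _ (inj₂ refl) (inj₁ refl) (inj₁ refl) = refl
heap⊗a-for-aPairs _ _ _ (inj₂ refl) (inj₁ refl) (inj₂ refl) = refl
heap⊗a-for-aPairs _ _ _ (inj₂ refl) (inj₂ refl) (inj₁ refl) = refl
heap⊗a-for-aPairs _ _ _ (inj₂ refl) (inj₂ refl) (inj₂ refl) = refl

-- A move to two heaps changes the number of heaps by one, so two P-values on either side differ in
-- length parity and one of them must be a; that leaves only a few positions to inspect.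
inP-no-move-to-two-heaps : ∀ k u v → TwoHeapOption k u v → ∀ z →
                           inP (heapValue k ⊗ z) ≡ true → inP (value (suc u ∷ suc v ∷ []) ⊗ z) ≡ false
inP-no-move-to-two-heaps k u v opt z kz∈P = ¬-not λ uvz∈P →
  refute uvz∈P (inP-lengthParity-change (heapValue k) (value (suc u ∷ suc v ∷ [])) z
                  (twoHeapOption-lengthParity opt) (lengthParity-pair u v) kz∈P uvz∈P)
  where
  refute : inP (value (suc u ∷ suc v ∷ []) ⊗ z) ≡ true →
           heapValue k ⊗ z ≡ a-elt ⊎ value (suc u ∷ suc v ∷ []) ⊗ z ≡ a-elt → ⊥
  refute uvz∈P (inj₁ e) with heap⊗z≡a k z e (twoHeapOption-2≤ opt)
  ... | refl , refl with trans (sym uvz∈P) (twoHeapOptions-of-3 u v opt)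
  ...   | ()
  refute _ (inj₂ e) with pair⊗z≡a u v z e
  ... | u-a , v-a , refl with trans (sym kz∈P) (heap⊗a-for-aPairs k u v opt u-a v-a)
  ...   | ()

inP-no-move-to-nothing : ∀ z → inP (heapValue 1 ⊗ z) ≡ true → inP z ≡ false
inP-no-move-to-nothing z 1z∈P = ¬-not λ z∈P →
  refute z 1z∈P z∈P (inP-lengthParity-change (heapValue 1) ε z refl refl 1z∈P z∈P)
  where
  refute : ∀ z → inP (heapValue 1 ⊗ z) ≡ true → inP z ≡ true → heapValue 1 ⊗ z ≡ a-elt ⊎ z ≡ a-elt → ⊥
  refute z _ z∈P (inj₁ e) with ⊗≡a⁻ (heapValue 1) z e
  ... | _ , z-pure , bits rewrite isAPower-η z z-pure (not≡true⇒≡false bits) with z∈P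
  ...   | ()
  refute _ () _ (inj₂ refl)

plainInP-b-exclusive : ∀ ι j → plainInP ι (suc j) ≡ true → plainInP (not ι) j ≡ false
plainInP-b-exclusive false (suc j) _ = refl

dInP-b-exclusive′ : ∀ ι j n → dInP (not ι) (suc j) n ≡ true → dInP ι j n ≡ false
dInP-b-exclusive′ ι j n h = subst (λ x → dInP x j n ≡ false) (not-involutive ι) (dInP-b-exclusive (not ι) j n h)

inP-no-move-to-one-heap-large : ∀ n z → inP (heapValue (8 + n) ⊗ z) ≡ true → inP (heapValue (7 + n) ⊗ z) ≡ false
inP-no-move-to-one-heap-large n (a^ ι b^ j · one) p = dInP-d-exclusive ι j n p
inP-no-move-to-one-heap-large n (a^ ι b^ j · c′) p = dInP-d-exclusive (not ι) (2 + j) n p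
inP-no-move-to-one-heap-large n (a^ ι b^ j · d′ m) p with m ≤? n
... | yes m≤n rewrite m≥n⇒m⊓n≡n (m≤n⇒m≤1+n m≤n) | m≥n⇒m⊔n≡m (m≤n⇒m≤1+n m≤n) | m≥n⇒m⊓n≡n m≤n | m≥n⇒m⊔n≡m m≤n =
  dInP-d-exclusive (not (odd m) xor ι) (m + 4 + j) n p
... | no m≰n rewrite m≤n⇒m⊓n≡m (≰⇒> m≰n) | m≤n⇒m⊔n≡n (≰⇒> m≰n) | m≤n⇒m⊓n≡m (<⇒≤ (≰⇒> m≰n)) | m≤n⇒m⊔n≡n (<⇒≤ (≰⇒> m≰n)) =
  dInP-b-exclusive′ (not (odd n) xor ι) (n + 4 + j) m
    (subst (λ x → dInP x (suc (n + 4 + j)) m ≡ true) (sym (not-distribˡ-xor (not (odd n)) ι)) p)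

inP-no-move-to-one-heap : ∀ i z → inP (heapValue (suc (suc i)) ⊗ z) ≡ true → inP (heapValue (suc i) ⊗ z) ≡ false
inP-no-move-to-one-heap 0 (a^ ι b^ j · one) p = plainInP-b-exclusive ι j p
inP-no-move-to-one-heap 0 (a^ true b^ zero · c′) p = refl
inP-no-move-to-one-heap 0 (a^ true b^ suc j · c′) p = refl
inP-no-move-to-one-heap 0 (a^ ι b^ j · d′ n) p = dInP-b-exclusive ι j n p
inP-no-move-to-one-heap 1 (a^ ι b^ j · one) p = exclusive-sym (plainInP-b-exclusive ι j) p
inP-no-move-to-one-heap 1 (a^ false b^ suc j · c′) p = refl
inP-no-move-to-one-heap 1 (a^ ι b^ j · d′ n) p = exclusive-sym (dInP-b-exclusive ι j n) p
inP-no-move-to-one-heap 2 (a^ ι b^ j · one) p = plainInP-b-exclusive ι j p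
inP-no-move-to-one-heap 2 (a^ true b^ zero · c′) p = refl
inP-no-move-to-one-heap 2 (a^ true b^ suc j · c′) p = refl
inP-no-move-to-one-heap 2 (a^ ι b^ j · d′ n) p = dInP-b-exclusive ι j n p
inP-no-move-to-one-heap 3 (a^ true b^ suc j · one) p = refl
inP-no-move-to-one-heap 3 (a^ false b^ zero · one) ()
inP-no-move-to-one-heap 3 (a^ false b^ suc j · one) ()
inP-no-move-to-one-heap 3 (a^ false b^ j · c′) p = refl
inP-no-move-to-one-heap 3 (a^ ι b^ j · d′ n) p = dInP-b-exclusive′ ι (suc j) n p
inP-no-move-to-one-heap 4 (a^ false b^ zero · one) p = refl
inP-no-move-to-one-heap 4 (a^ false b^ suc j · one) p = refl
inP-no-move-to-one-heap 4 (a^ true b^ j · c′) p = refl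
inP-no-move-to-one-heap 4 (a^ ι b^ j · d′ n) p = dInP-b-exclusive ι (suc (suc j)) n p
inP-no-move-to-one-heap 5 (a^ ι b^ j · one) p with dInP⇒InPWithD {ι} {j} {0} p
... | above _ refl _ = refl
inP-no-move-to-one-heap 5 (a^ ι b^ j · c′) p with dInP⇒InPWithD {not ι} {2 + j} {0} p
inP-no-move-to-one-heap 5 (a^ false b^ j · c′) p | above _ _ _ = refl
inP-no-move-to-one-heap 5 (a^ true  b^ j · c′) p | above _ () _
inP-no-move-to-one-heap 5 (a^ ι b^ j · d′ n) p = dInP-b-exclusive′ ι (3 + j) n p
inP-no-move-to-one-heap (suc (suc (suc (suc (suc (suc n)))))) z p = inP-no-move-to-one-heap-large n z p

inP-no-move-to-P : ∀ {k R} → HeapOption k R → ∀ z → inP (heapValue k ⊗ z) ≡ true → inP (value R ⊗ z) ≡ false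
inP-no-move-to-P (split i j)   z p = inP-no-move-to-two-heaps _ i j (inj₁ refl) z p
inP-no-move-to-P remove0       z p = inP-no-move-to-nothing z p
inP-no-move-to-P (remove1 i)   z p =
  subst (λ w → inP (w ⊗ z) ≡ false) (sym (⊗-identityʳ (heapValue (suc i)))) (inP-no-move-to-one-heap i z p)
inP-no-move-to-P (remove2 i j) z p = inP-no-move-to-two-heaps _ i j (inj₂ refl) z p

-- A move into 𝒫 from every other nonempty position

TailAtMost : ℕ → Tail → Set
TailAtMost n t = t ≡ one ⊎ t ≡ c′ ⊎ Σ ℕ λ m → t ≡ d′ m × m ≤ n

WinningOption : ℕ → Elt → Set
WinningOption k z = Σ (List ℕ) λ R → HeapOption k R × inP (value R ⊗ z) ≡ true

-- Below a largest heap H(7+n), i.e. in a context z whose d-index is at most n, the value of an option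
-- is read off from the coordinates of heapValue (7 + n) ⊗ z.
inP-dOption : ∀ n z e f m → TailAtMost n (tailOf z) → m ≤ n → n ≤ 2 + m →
              inP ((a^ e b^ f · d′ m) ⊗ z) ≡ dInP (e xor aBit (heapValue (7 + n) ⊗ z)) (f + bExp (heapValue (7 + n) ⊗ z)) m
inP-dOption n (a^ ι b^ j · one) e f m _ _ _ = refl
inP-dOption n (a^ ι b^ j · c′)  e f m _ _ _ = cong₂ (λ x y → dInP x y m) (not-distribʳ-xor e ι) (arith j f)
  where
  arith : ∀ j f → 2 + (f + j) ≡ f + (2 + j)
  arith = solve-∀
inP-dOption n (a^ ι b^ j · d′ N) e f m (inj₂ (inj₂ (_ , refl , N≤n))) m≤n n≤2+m
  rewrite m≥n⇒m⊓n≡n N≤n with N ≤? m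
... | yes N≤m rewrite m≥n⇒m⊓n≡n N≤m | m≥n⇒m⊔n≡m N≤m =
  cong₂ (λ x y → dInP x y m) (solve 3 (λ x e ι → x ⊕ (e ⊕ ι) ⊜ e ⊕ (x ⊕ ι)) refl (not (odd N)) e ι) (arith N j f)
  where
  open XorSolver using (solve; _⊕_; _⊜_)
  arith : ∀ N j f → N + 4 + (f + j) ≡ f + (N + 4 + (0 + j))
  arith = solve-∀
... | no N≰m rewrite m≤n⇒m⊓n≡m (<⇒≤ (≰⇒> N≰m)) | m≤n⇒m⊔n≡n (<⇒≤ (≰⇒> N≰m)) =
  trans (dInP-> _ N<lhs) (trans (cong₂ plainInP bits (arith₁ m N f j)) (sym (dInP-> _ m<rhs)))
  where
  open XorSolver using (solve; _⊕_; _⊜_)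
  bits : (not (odd m) xor (e xor ι)) xor not (odd N) ≡ (e xor (not (odd N) xor ι)) xor not (odd m)
  bits = solve 4 (λ x y e ι → (x ⊕ (e ⊕ ι)) ⊕ y ⊜ (e ⊕ (y ⊕ ι)) ⊕ x) refl (not (odd m)) (not (odd N)) e ι
  arith₁ : ∀ m N f j → m + 4 + (f + j) + N + 4 ≡ f + (N + 4 + (0 + j)) + m + 4
  arith₁ = solve-∀
  arith₂ : ∀ m f j → 3 + m ≤ m + 4 + (f + j)
  arith₂ m f j = ≤-trans (≤-reflexive (+-comm 3 m)) (≤-trans (+-monoʳ-≤ m (n≤1+n 3)) (m≤m+n (m + 4) (f + j)))
  N<lhs : N < m + 4 + (f + j)
  N<lhs = ≤-trans (s≤s (≤-trans N≤n n≤2+m)) (arith₂ m f j)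
  m<rhs : m < f + (N + 4 + (0 + j))
  m<rhs = ≤-trans (≰⇒> N≰m) (≤-trans (m≤m+n N (4 + j)) (≤-trans (≤-reflexive (sym (+-assoc N 4 j))) (m≤n+m _ f)))

inP-plainOption : ∀ n z e f → TailAtMost n (tailOf z) → n < f →
                  inP ((a^ e b^ f · one) ⊗ z) ≡ plainInP (e xor aBit (heapValue (7 + n) ⊗ z)) (f + bExp (heapValue (7 + n) ⊗ z))
inP-plainOption n (a^ ι b^ j · one) e f _ _ = refl
inP-plainOption n (a^ ι b^ j · c′)  e (suc f) _ _ = cong₂ plainInP (not-distribʳ-xor e ι) (arith f j)
  where
  arith : ∀ f j → 3 + (f + j) ≡ suc f + (2 + j)
  arith = solve-∀
inP-plainOption n (a^ ι b^ j · d′ N) e f (inj₂ (inj₂ (_ , refl , N≤n))) n<f rewrite m≥n⇒m⊓n≡n N≤n =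
  trans (dInP-> _ (≤-trans (s≤s N≤n) (≤-trans n<f (m≤m+n f j))))
        (cong₂ plainInP (solve 3 (λ x e ι → (e ⊕ ι) ⊕ x ⊜ e ⊕ (x ⊕ ι)) refl (not (odd N)) e ι) (arith N f j))
  where
  open XorSolver using (solve; _⊕_; _⊜_)
  arith : ∀ N f j → f + j + N + 4 ≡ f + (N + 4 + j)
  arith = solve-∀

≡true⇒≢false : ∀ {x} → x ≡ true → x ≢ false
≡true⇒≢false refl ()

xor-cancelʳ : ∀ x y → (x xor y) xor y ≡ x
xor-cancelʳ x y = trans (xor-assoc x y y) (trans (cong (x xor_) (xor-same y)) (xor-identityʳ x))

odd-cases : ∀ m n → odd m ≡ odd n ⊎ odd m ≡ not (odd n)
odd-cases m n with odd m | odd n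
... | true  | true  = inj₁ refl
... | true  | false = inj₂ refl
... | false | true  = inj₂ refl
... | false | false = inj₁ refl

odd-2+ : ∀ p → odd (2 + p) ≡ odd p
odd-2+ p = not-involutive (odd p)

dInP≡false-below : ∀ {i j n} → j < n → dInP i j n ≡ false → odd j ≡ not (odd n) → i ≡ not (odd n)
dInP≡false-below j<n ∉P oj = ¬-not λ i≡ → ≡true⇒≢false (InPWithD⇒dInP (below j<n i≡ oj)) ∉P

dInP≡false-above : ∀ {i j n} → n < j → dInP i j n ≡ false → odd j ≡ odd n → i ≡ odd n
dInP≡false-above n<j ∉P oj = trans (¬-not (λ i≡ → ≡true⇒≢false (InPWithD⇒dInP (above n<j i≡ oj)) ∉P)) (not-involutive _)

SmallerDTarget : Bool → ℕ → ℕ → Set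
SmallerDTarget I J p = (Σ Bool λ e → dInP (e xor I) J (suc p) ≡ true) ⊎ dInP (not I) J p ≡ true ⊎ dInP I (suc J) p ≡ true

dInP-smallerTarget : ∀ p I J → dInP I J (2 + p) ≡ false → J ≢ 2 + p → SmallerDTarget I J p
dInP-smallerTarget p I J ∉P J≢ with <-cmp J (2 + p) | odd-cases J p
... | tri≈ _ J≡ _ | _ = ⊥-elim (J≢ J≡)
... | tri< J<N _ _ | inj₁ oJ≡op =
  inj₁ (odd (suc p) xor I , InPWithD⇒dInP (below J<1+p (xor-cancelʳ _ I) (trans oJ≡op (sym (not-involutive _)))))
  where
  J<1+p : J < suc p
  J<1+p = ≤∧≢⇒< (≤-pred J<N) λ J≡ → x≢not-x (trans (sym oJ≡op) (cong odd J≡))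
... | tri< J<N _ _ | inj₂ oJ≡nop with <-cmp J p
...   | tri< J<p _ _ = inj₂ (inj₁ (InPWithD⇒dInP (below J<p notI≡op oJ≡nop)))
  where
  notI≡op : not I ≡ odd p
  notI≡op = trans (cong not (dInP≡false-below J<N ∉P (trans oJ≡nop (cong not (sym (odd-2+ p))))))
                  (trans (not-involutive _) (odd-2+ p))
...   | tri≈ _ J≡p _ = ⊥-elim (x≢not-x (trans (cong odd (sym J≡p)) oJ≡nop))
...   | tri> _ _ p<J = inj₂ (inj₂ (InPWithD⇒dInP (above (m<n⇒m<1+n p<J) I≡nop (trans (cong not oJ≡nop) (not-involutive _)))))
  where
  I≡nop : I ≡ not (odd p)
  I≡nop = trans (dInP≡false-below J<N ∉P (trans oJ≡nop (cong not (sym (odd-2+ p))))) (cong not (odd-2+ p))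
dInP-smallerTarget p I J ∉P J≢ | tri> _ _ N<J | inj₁ oJ≡op =
  inj₂ (inj₁ (InPWithD⇒dInP (above (<-trans (≤-trans (n<1+n p) (n≤1+n (suc p))) N<J) (cong not I≡op) oJ≡op)))
  where
  I≡op : I ≡ odd p
  I≡op = trans (dInP≡false-above N<J ∉P (trans oJ≡op (sym (odd-2+ p)))) (odd-2+ p)
dInP-smallerTarget p I J ∉P J≢ | tri> _ _ N<J | inj₂ oJ≡nop =
  inj₁ (not (odd (suc p)) xor I , InPWithD⇒dInP (above (<-trans (n<1+n (suc p)) N<J) (xor-cancelʳ _ I) oJ≡nop))

dInP-smallerTarget-0 : ∀ I J → 0 < J → dInP I J 0 ≡ false →
                       plainInP I (3 + J) ≡ true ⊎ plainInP I (2 + J) ≡ true ⊎ plainInP (not I) (3 + J) ≡ true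
dInP-smallerTarget-0 I J 0<J ∉P with odd J in oJ
dInP-smallerTarget-0 false J 0<J ∉P | true  = inj₁ (trans (not-involutive _) oJ)
dInP-smallerTarget-0 false J 0<J ∉P | false = inj₂ (inj₁ (cong not oJ))
dInP-smallerTarget-0 true  J 0<J ∉P | true  = inj₂ (inj₂ (trans (not-involutive _) oJ))
dInP-smallerTarget-0 true  J 0<J ∉P | false = ⊥-elim (≡true⇒≢false (InPWithD⇒dInP {true} {J} {0} (above 0<J refl oJ)) ∉P)

dInP-smallerTarget-1 : ∀ I J → J ≢ 1 → dInP I J 1 ≡ false →
                       plainInP I (2 + J) ≡ true ⊎ dInP I J 0 ≡ true ⊎ plainInP (not I) (3 + J) ≡ true
dInP-smallerTarget-1 false zero _ _ = inj₁ refl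
dInP-smallerTarget-1 true  zero _ ()
dInP-smallerTarget-1 I (suc zero) J≢1 _ = ⊥-elim (J≢1 refl)
dInP-smallerTarget-1 I (suc (suc J)) _ ∉P with odd J in oJ
dInP-smallerTarget-1 false (suc (suc J)) _ ∉P | false = inj₁ (trans (not-involutive _) (cong not oJ))
dInP-smallerTarget-1 true  (suc (suc J)) _ ∉P | false =
  inj₂ (inj₁ (InPWithD⇒dInP {true} {suc (suc J)} {0} (above (s≤s z≤n) refl (trans (not-involutive _) oJ))))
dInP-smallerTarget-1 true  (suc (suc J)) _ ∉P | true  = inj₂ (inj₂ (trans (not-involutive _) (trans (not-involutive _) oJ)))
dInP-smallerTarget-1 false (suc (suc J)) _ ∉P | true  =
  ⊥-elim (≡true⇒≢false (InPWithD⇒dInP {false} {suc (suc J)} {1} (above (s≤s (s≤s z≤n)) refl (trans (not-involutive _) oJ))) ∉P)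

tail-largestHeap : ∀ n z → TailAtMost n (tailOf z) → tailOf (heapValue (7 + n) ⊗ z) ≡ d′ n
tail-largestHeap n (a^ _ b^ _ · one) _ = refl
tail-largestHeap n (a^ _ b^ _ · c′)  _ = refl
tail-largestHeap n (a^ _ b^ _ · d′ m) (inj₂ (inj₂ (_ , refl , m≤n))) = cong d′ (m≥n⇒m⊔n≡m m≤n)

inP-tail-d : ∀ y n → tailOf y ≡ d′ n → inP y ≡ dInP (aBit y) (bExp y) n
inP-tail-d (a^ _ b^ _ · _) n refl = refl

inP-largestHeap : ∀ n z → TailAtMost n (tailOf z) →
                  inP (heapValue (7 + n) ⊗ z) ≡ dInP (aBit (heapValue (7 + n) ⊗ z)) (bExp (heapValue (7 + n) ⊗ z)) n
inP-largestHeap n z tb = inP-tail-d (heapValue (7 + n) ⊗ z) n (tail-largestHeap n z tb)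

-- The options H(6+n), H1+H(6+n), H1+H(5+n) and H2+H(5+n) of the largest heap H(7+n) realise the four
-- targets of dInP-smallerTarget.
winningOption-largestHeap : ∀ n z → TailAtMost n (tailOf z) → inP (heapValue (7 + n) ⊗ z) ≡ false →
                            bExp (heapValue (7 + n) ⊗ z) ≢ n → WinningOption (7 + n) z
winningOption-largestHeap 0 z tb ∉P J≢
  with dInP-smallerTarget-0 (aBit y) (bExp y) (n≢0⇒n>0 J≢) (trans (sym (inP-largestHeap 0 z tb)) ∉P)
  where y = heapValue 7 ⊗ z
... | inj₁ h        = (6 ∷ [])     , remove1 5   , trans (inP-plainOption 0 z false 3 tb (s≤s z≤n)) h
... | inj₂ (inj₁ h) = (2 ∷ 4 ∷ []) , remove2 1 3 , trans (inP-plainOption 0 z false 2 tb (s≤s z≤n)) h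
... | inj₂ (inj₂ h) = (1 ∷ 6 ∷ []) , split 0 5   , trans (inP-plainOption 0 z true 3 tb (s≤s z≤n)) h
winningOption-largestHeap 1 z tb ∉P J≢
  with dInP-smallerTarget-1 (aBit y) (bExp y) J≢ (trans (sym (inP-largestHeap 1 z tb)) ∉P)
  where y = heapValue 8 ⊗ z
... | inj₁ h        = (4 ∷ 4 ∷ []) , split 3 3   , trans (inP-plainOption 1 z false 2 tb (s≤s (s≤s z≤n))) h
... | inj₂ (inj₁ h) = (7 ∷ [])     , remove1 6   , trans (inP-dOption 1 z false 0 0 tb z≤n (s≤s z≤n)) h
... | inj₂ (inj₂ h) = (1 ∷ 6 ∷ []) , remove2 0 5 , trans (inP-plainOption 1 z true 3 tb (s≤s (s≤s z≤n))) h
winningOption-largestHeap (suc (suc p)) z tb ∉P J≢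
  with dInP-smallerTarget p (aBit y) (bExp y) (trans (sym (inP-largestHeap (2 + p) z tb)) ∉P) J≢
  where y = heapValue (9 + p) ⊗ z
... | inj₁ (false , h) = (8 + p ∷ [])    , remove1 (7 + p)   , trans (inP-dOption (2 + p) z false 0 (suc p) tb (n≤1+n _) (n≤1+n _)) h
... | inj₁ (true , h)  = (1 ∷ 8 + p ∷ []) , split 0 (7 + p)   , trans (inP-dOption (2 + p) z true 0 (suc p) tb (n≤1+n _) (n≤1+n _)) h
... | inj₂ (inj₁ h)    = (1 ∷ 7 + p ∷ []) , remove2 0 (6 + p) , trans (inP-dOption (2 + p) z true 0 p tb (m≤n+m p 2) ≤-refl) h
... | inj₂ (inj₂ h)    = (2 ∷ 7 + p ∷ []) , split 1 (6 + p)   , trans (inP-dOption (2 + p) z false 1 p tb (m≤n+m p 2) ≤-refl) h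

true≢false : true ≢ false
true≢false ()

carriesB : ℕ → Bool
carriesB 0 = false
carriesB 1 = false
carriesB 2 = true
carriesB 3 = false
carriesB 4 = true
carriesB 5 = true
carriesB 6 = true
carriesB (suc (suc (suc (suc (suc (suc (suc _))))))) = true

bit-cases : ∀ x y → x ≡ y ⊎ not x ≡ y
bit-cases true  true  = inj₁ refl
bit-cases true  false = inj₂ refl
bit-cases false true  = inj₂ refl
bit-cases false false = inj₁ refl

dInP-just-below : ∀ j x → x ≡ odd (suc j) → dInP x j (suc j) ≡ true
dInP-just-below j x x≡ = InPWithD⇒dInP (below (n<1+n j) x≡ (sym (not-involutive _)))

inP-d⊗d : ∀ m n e ι j → m ≤ n → inP ((a^ e b^ 0 · d′ m) ⊗ (a^ ι b^ j · d′ n)) ≡ dInP (not (odd m) xor (e xor ι)) (m + 4 + j) n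
inP-d⊗d m n e ι j m≤n rewrite m≤n⇒m⊓n≡m m≤n | m≤n⇒m⊔n≡n m≤n = refl

-- When the b-exponent already equals the d-index n, a heap carrying b moves to a^x b^(n-1) d_n, choosing
-- between two options to fix the bit x = odd n.
winningOption-bExp≡n : ∀ n h x → tailOf x ≡ d′ n → carriesB h ≡ true → h ≤ 7 + n → bExp (heapValue h ⊗ x) ≡ n →
                       WinningOption h x
winningOption-bExp≡n n 2 (a^ ι b^ j · d′ .n) refl _ _ refl with bit-cases ι (odd (suc j))
... | inj₁ e = (1 ∷ 1 ∷ []) , split 0 0 , dInP-just-below j ι e
... | inj₂ e = (1 ∷ [])     , remove1 0 , dInP-just-below j (not ι) e
winningOption-bExp≡n n 4 (a^ ι b^ j · d′ .n) refl _ _ refl with bit-cases ι (odd (suc j))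
... | inj₁ e = (1 ∷ 3 ∷ []) , split 0 2 , dInP-just-below j ι e
... | inj₂ e = (3 ∷ [])     , remove1 2 , dInP-just-below j (not ι) e
winningOption-bExp≡n n 5 (a^ ι b^ j · d′ .n) refl _ _ refl with bit-cases ι (odd (2 + j))
... | inj₁ e = (4 ∷ [])     , remove1 3 , dInP-just-below (suc j) ι e
... | inj₂ e = (1 ∷ 4 ∷ []) , split 0 3 , dInP-just-below (suc j) (not ι) e
winningOption-bExp≡n n 6 (a^ ι b^ j · d′ .n) refl _ _ refl with bit-cases ι (odd (3 + j))
... | inj₁ e = (2 ∷ 4 ∷ []) , split 1 3 , dInP-just-below (2 + j) ι e
... | inj₂ e = (5 ∷ [])     , remove1 4 , dInP-just-below (2 + j) (not ι) e
winningOption-bExp≡n n 7 (a^ ι b^ j · d′ .n) refl _ _ refl with bit-cases ι (odd (4 + j))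
... | inj₁ e = (6 ∷ [])     , remove1 5 , dInP-just-below (3 + j) ι e
... | inj₂ e = (1 ∷ 6 ∷ []) , split 0 5 , dInP-just-below (3 + j) (not ι) e
winningOption-bExp≡n n (suc (suc (suc (suc (suc (suc (suc (suc m)))))))) (a^ ι b^ j · d′ .n) refl _ 8+m≤7+n bExp≡n =
  win (+-cancelˡ-≤ 7 _ _ 8+m≤7+n) bExp≡n
  where
  win : suc m ≤ n → bExp (heapValue (8 + m) ⊗ (a^ ι b^ j · d′ n)) ≡ n → WinningOption (8 + m) (a^ ι b^ j · d′ n)
  win m<n e rewrite m≤n⇒m⊓n≡m m<n with e
  ... | refl with bit-cases (not (odd m) xor ι) (odd (suc (m + 4 + j)))
  ...   | inj₁ q = (7 + m ∷ []) , remove1 (6 + m) ,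
                   trans (inP-d⊗d m _ false ι j (<⇒≤ m<n)) (dInP-just-below (m + 4 + j) _ q)
  ...   | inj₂ q = (1 ∷ 7 + m ∷ []) , split 0 (6 + m) ,
                   trans (inP-d⊗d m _ true ι j (<⇒≤ m<n))
                         (dInP-just-below (m + 4 + j) _ (trans (sym (not-distribʳ-xor (not (odd m)) ι)) q))

winningOption-7-with-a : ∀ ι → WinningOption 7 (a^ ι b^ 0 · one)
winningOption-7-with-a true  = (3 ∷ 3 ∷ []) , remove2 2 2 , refl
winningOption-7-with-a false = (2 ∷ 4 ∷ []) , remove2 1 3 , refl

TailNotD : Tail → Set
TailNotD t = t ≡ one ⊎ t ≡ c′

winningOption-6 : ∀ z → TailNotD (tailOf z) → inP (heapValue 6 ⊗ z) ≡ false → WinningOption 6 z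
winningOption-6 (a^ false b^ j · one) _ ∉P with odd j in e
... | false = (2 ∷ 4 ∷ []) , split 1 3 , cong not e
... | true  = ⊥-elim (true≢false ∉P)
winningOption-6 (a^ true b^ zero · one) _ ∉P = (3 ∷ 3 ∷ []) , split 2 2 , refl
winningOption-6 (a^ true b^ suc j · one) _ ∉P with odd j in e
... | false = (1 ∷ 4 ∷ []) , remove2 0 3 , cong not e
... | true = (5 ∷ []) , remove1 4 , trans (not-involutive _) e
winningOption-6 (a^ false b^ j · c′) _ ∉P with odd j in e
... | false = (5 ∷ []) , remove1 4 , trans (not-involutive _) (cong not e)
... | true = (1 ∷ 4 ∷ []) , remove2 0 3 , trans (not-involutive _) e
winningOption-6 (a^ true b^ j · c′) _ ∉P with odd j in e
... | false = (2 ∷ 4 ∷ []) , split 1 3 , cong (λ x → not (not (not x))) e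
... | true  = ⊥-elim (true≢false ∉P)
winningOption-6 (a^ ι b^ j · d′ x) (inj₁ ()) _
winningOption-6 (a^ ι b^ j · d′ x) (inj₂ ()) _

winningOption-5 : ∀ z → TailNotD (tailOf z) → inP (heapValue 5 ⊗ z) ≡ false → WinningOption 5 z
winningOption-5 (a^ false b^ j · one) _ ∉P with odd j in e
... | false = (2 ∷ 2 ∷ []) , remove2 1 1 , cong not e
winningOption-5 (a^ false b^ suc j · one) _ ∉P | true = (4 ∷ []) , remove1 3 , e
winningOption-5 (a^ true b^ zero · one) _ ∉P = (1 ∷ 3 ∷ []) , remove2 0 2 , refl
winningOption-5 (a^ true b^ suc j · one) _ ∉P with odd j in e
... | false = (1 ∷ 4 ∷ []) , split 0 3 , cong not e
... | true = ⊥-elim (true≢false ∉P)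
winningOption-5 (a^ true b^ j · c′) _ ∉P with odd j in e
... | false = (2 ∷ 2 ∷ []) , remove2 1 1 , trans (not-involutive _) (cong not e)
... | true = (4 ∷ []) , remove1 3 , trans (not-involutive _) e
winningOption-5 (a^ false b^ j · c′) _ ∉P with odd j in e
... | true = (1 ∷ 4 ∷ []) , split 0 3 , trans (not-involutive _) e
... | false = ⊥-elim (true≢false ∉P)
winningOption-5 (a^ ι b^ j · d′ x) (inj₁ ()) _
winningOption-5 (a^ ι b^ j · d′ x) (inj₂ ()) _

winningOption-4 : ∀ ι j → inP (heapValue 4 ⊗ (a^ ι b^ j · one)) ≡ false → WinningOption 4 (a^ ι b^ j · one)
winningOption-4 false j ∉P with odd j in e
... | false = (2 ∷ 2 ∷ []) , split 1 1 , cong not e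
winningOption-4 false (suc j) ∉P | true = ⊥-elim (true≢false (trans (sym e) ∉P))
winningOption-4 true zero ∉P = (1 ∷ 3 ∷ []) , split 0 2 , refl
winningOption-4 true (suc zero) ∉P = (1 ∷ 2 ∷ []) , remove2 0 1 , refl
winningOption-4 true (suc (suc j)) ∉P with odd j in e
... | true = (1 ∷ 2 ∷ []) , remove2 0 1 , trans (not-involutive _) e
... | false = (3 ∷ []) , remove1 2 , cong not e

winningOption-3 : ∀ ι j → inP (heapValue 3 ⊗ (a^ ι b^ j · one)) ≡ false → WinningOption 3 (a^ ι b^ j · one)
winningOption-3 false zero ()
winningOption-3 false (suc j) ∉P with odd j in e
... | false = (2 ∷ []) , remove1 1 , cong not e
winningOption-3 false (suc (suc j)) ∉P | true = (1 ∷ 1 ∷ []) , remove2 0 0 , e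
winningOption-3 true zero ∉P = (1 ∷ 1 ∷ []) , remove2 0 0 , refl
winningOption-3 true (suc zero) ∉P = (1 ∷ 2 ∷ []) , split 0 1 , refl
winningOption-3 true (suc (suc j)) ∉P with odd j in e
... | true = (1 ∷ 2 ∷ []) , split 0 1 , trans (not-involutive _) e
... | false = ⊥-elim (true≢false ∉P)

winningOption-2 : ∀ ι j → inP (heapValue 2 ⊗ (a^ ι b^ j · one)) ≡ false → ¬ (ι ≡ true × odd j ≡ true) → WinningOption 2 (a^ ι b^ j · one)
winningOption-2 false zero ∉P _ = (1 ∷ []) , remove1 0 , refl
winningOption-2 false (suc zero) () _
winningOption-2 false (suc (suc j)) ∉P _ with odd j in e
... | false = (1 ∷ 1 ∷ []) , split 0 0 , cong not e
... | true  = ⊥-elim (true≢false ∉P)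
winningOption-2 true zero ∉P _ = (1 ∷ 1 ∷ []) , split 0 0 , refl
winningOption-2 true (suc zero) ∉P cnd = ⊥-elim (cnd (refl , refl))
winningOption-2 true (suc (suc j)) ∉P cnd with odd j in e
... | false = (1 ∷ []) , remove1 0 , cong not e
... | true  = ⊥-elim (cnd (refl , refl))

winningOption-1 : ∀ ι j → inP (heapValue 1 ⊗ (a^ ι b^ j · one)) ≡ false → (j ≡ 0 ⊎ (ι ≡ false × odd j ≡ false)) → WinningOption 1 (a^ ι b^ j · one)
winningOption-1 false zero () _
winningOption-1 true zero ∉P _ = [] , remove0 , refl
winningOption-1 ι (suc j) ∉P (inj₁ ())
winningOption-1 .false (suc zero) ∉P (inj₂ (refl , ()))
winningOption-1 .false (suc (suc j)) ∉P (inj₂ (refl , o)) = [] , remove0 , cong not (trans (sym (not-involutive _)) o)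



value-++ : ∀ xs ys → value (xs ++ ys) ≡ value xs ⊗ value ys
value-++ []       ys = sym (⊗-identityˡ (value ys))
value-++ (k ∷ xs) ys rewrite value-++ xs ys = sym (⊗-assoc (heapValue k) (value xs) (value ys))

value-↭ : ∀ {xs ys} → xs ↭ ys → value xs ≡ value ys
value-↭ ↭.refl          = refl
value-↭ (↭.prep x p)    = cong (heapValue x ⊗_) (value-↭ p)
value-↭ (↭.swap x y p)  = trans (⊗-swapˡ (heapValue x) (heapValue y) _) (cong (λ w → heapValue y ⊗ (heapValue x ⊗ w)) (value-↭ p))
value-↭ (↭.trans p q)   = trans (value-↭ p) (value-↭ q)

∈⇒↭ : ∀ {k G} → k ∈ G → Σ Position λ rest → G ↭ k ∷ rest
∈⇒↭ {k} k∈G with ∈-∃++ k∈G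
... | xs , ys , refl = xs ++ ys , shift k xs ys

All-↭-∷ : ∀ {P : ℕ → Set} {G k rest} → All P G → G ↭ k ∷ rest → P k × All P rest
All-↭-∷ all p with All-resp-↭ p all
... | pk ∷ prest = pk , prest

move-at : ∀ {G k rest R} → G ↭ k ∷ rest → HeapOption k R → Σ Position λ G′ → Move G G′ × value G′ ≡ value R ⊗ value rest
move-at {k = k} {rest} {R} p o with ∈-∃++ (∈-resp-↭ (↭-sym p) (here refl))
... | xs , ys , refl = xs ++ R ++ ys , move xs k ys R o , (begin
  value (xs ++ R ++ ys)    ≡⟨ value-↭ (shifts xs R) ⟩
  value (R ++ xs ++ ys)    ≡⟨ value-++ R (xs ++ ys) ⟩
  value R ⊗ value (xs ++ ys) ≡⟨ cong (value R ⊗_) (value-↭ (drop-∷ (↭-trans (↭-sym (shift k xs ys)) p))) ⟩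
  value R ⊗ value rest     ∎)
  where open ≡-Reasoning

HasWinningMove : Position → Set
HasWinningMove G = Σ Position λ G′ → Move G G′ × inP (value G′) ≡ true

winningOption⇒winningMove : ∀ {G k rest} → G ↭ k ∷ rest → WinningOption k (value rest) → HasWinningMove G
winningOption⇒winningMove p (R , o , R∈P) with move-at p o
... | G′ , m , e = G′ , m , trans (cong inP e) R∈P

findHeap : (p : ℕ → Bool) → ∀ G → (Σ ℕ λ k → Σ Position λ rest → p k ≡ true × G ↭ k ∷ rest) ⊎ All (λ k → p k ≡ false) G
findHeap p []      = inj₂ []
findHeap p (k ∷ G) with p k in e
... | true  = inj₁ (k , G , e , ↭-refl)
... | false with findHeap p G
...   | inj₂ none                   = inj₂ (e ∷ none)
...   | inj₁ (k′ , rest , e′ , q)   = inj₁ (k′ , k ∷ rest , e′ , ↭-trans (↭-prep k q) (↭-swap k k′ ↭-refl))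

maxHeap : Position → ℕ
maxHeap []      = 0
maxHeap (k ∷ G) = k ⊔ maxHeap G

maxHeap-bounds : ∀ G → All (_≤ maxHeap G) G
maxHeap-bounds []      = []
maxHeap-bounds (k ∷ G) = m≤m⊔n k (maxHeap G) ∷ All.map (λ k≤ → ≤-trans k≤ (m≤n⊔m k (maxHeap G))) (maxHeap-bounds G)

maxHeap-∈ : ∀ G → 1 ≤ maxHeap G → maxHeap G ∈ G
maxHeap-∈ (k ∷ G) 1≤M with ≤-total (maxHeap G) k
... | inj₁ M≤k rewrite m≥n⇒m⊔n≡m M≤k = here refl
... | inj₂ k≤M rewrite m≤n⇒m⊔n≡n k≤M = there (maxHeap-∈ G 1≤M)

value-preserves : ∀ (Q : Elt → Set) → Q ε → (∀ x y → Q x → Q y → Q (x ⊗ y)) →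
                  ∀ {G} → All (λ k → Q (heapValue k)) G → Q (value G)
value-preserves Q Qε Q⊗ []         = Qε
value-preserves Q Qε Q⊗ (Qk ∷ QG) = Q⊗ _ _ Qk (value-preserves Q Qε Q⊗ QG)

⊗-tailAtMost : ∀ n x y → TailAtMost n (tailOf x) → TailAtMost n (tailOf y) → TailAtMost n (tailOf (x ⊗ y))
⊗-tailAtMost n x y = closed (tailOf x) (tailOf y)
  where
  closed : ∀ s t → TailAtMost n s → TailAtMost n t → TailAtMost n (tailOf (s ⋆ t))
  closed one    t      _ tt = tt
  closed c′     one    _ _  = inj₂ (inj₁ refl)
  closed c′     c′     _ _  = inj₁ refl
  closed c′     (d′ m) _ tt = tt
  closed (d′ m) one    ts _ = ts
  closed (d′ m) c′     ts _ = ts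
  closed (d′ m) (d′ m′) (inj₂ (inj₂ (_ , refl , m≤n))) (inj₂ (inj₂ (_ , refl , m′≤n))) = inj₂ (inj₂ (m ⊔ m′ , refl , ⊔-lub m≤n m′≤n))

⊗-tailNotD : ∀ x y → TailNotD (tailOf x) → TailNotD (tailOf y) → TailNotD (tailOf (x ⊗ y))
⊗-tailNotD x y = closed (tailOf x) (tailOf y)
  where
  closed : ∀ s t → TailNotD s → TailNotD t → TailNotD (tailOf (s ⋆ t))
  closed one t  _ tt = tt
  closed c′ one _ _  = inj₂ refl
  closed c′ c′  _ _  = inj₁ refl
  closed c′ (d′ _) _ (inj₁ ())
  closed c′ (d′ _) _ (inj₂ ())
  closed (d′ _) _ (inj₁ ()) _
  closed (d′ _) _ (inj₂ ()) _

⊗-isAPower : ∀ x y → IsAPower x → IsAPower y → IsAPower (x ⊗ y)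
⊗-isAPower (a^ _ b^ _ · _) (a^ _ b^ _ · _) (refl , refl) (refl , refl) = refl , refl

NoA : Elt → Set
NoA x = aBit x ≡ false × tailOf x ≡ one

⊗-noA : ∀ x y → NoA x → NoA y → NoA (x ⊗ y)
⊗-noA (a^ _ b^ _ · _) (a^ _ b^ _ · _) (refl , refl) (refl , refl) = refl , refl

heap-tailAtMost : ∀ n {k} → k ≤ 7 + n → TailAtMost n (tailOf (heapValue k))
heap-tailAtMost n {0} _ = inj₁ refl
heap-tailAtMost n {1} _ = inj₁ refl
heap-tailAtMost n {2} _ = inj₁ refl
heap-tailAtMost n {3} _ = inj₁ refl
heap-tailAtMost n {4} _ = inj₁ refl
heap-tailAtMost n {5} _ = inj₂ (inj₁ refl)
heap-tailAtMost n {6} _ = inj₁ refl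
heap-tailAtMost n {suc (suc (suc (suc (suc (suc (suc m))))))} k≤ = inj₂ (inj₂ (m , refl , +-cancelˡ-≤ 7 _ _ k≤))

heap-tailNotD : ∀ {k} → k ≤ 6 → TailNotD (tailOf (heapValue k))
heap-tailNotD {0} _ = inj₁ refl
heap-tailNotD {1} _ = inj₁ refl
heap-tailNotD {2} _ = inj₁ refl
heap-tailNotD {3} _ = inj₁ refl
heap-tailNotD {4} _ = inj₁ refl
heap-tailNotD {5} _ = inj₂ refl
heap-tailNotD {6} _ = inj₁ refl
heap-tailNotD {suc (suc (suc (suc (suc (suc (suc _))))))} (s≤s (s≤s (s≤s (s≤s (s≤s (s≤s ()))))))

heap-tailOne : ∀ {k} → k ≤ 4 → tailOf (heapValue k) ≡ one
heap-tailOne {0} _ = refl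
heap-tailOne {1} _ = refl
heap-tailOne {2} _ = refl
heap-tailOne {3} _ = refl
heap-tailOne {4} _ = refl
heap-tailOne {suc (suc (suc (suc (suc _))))} (s≤s (s≤s (s≤s (s≤s ()))))

¬carriesB⇒isAPower : ∀ {k} → carriesB k ≡ false → IsAPower (heapValue k)
¬carriesB⇒isAPower {0} _ = refl , refl
¬carriesB⇒isAPower {1} _ = refl , refl
¬carriesB⇒isAPower {3} _ = refl , refl
¬carriesB⇒isAPower {2} ()
¬carriesB⇒isAPower {4} ()
¬carriesB⇒isAPower {5} ()
¬carriesB⇒isAPower {6} ()
¬carriesB⇒isAPower {suc (suc (suc (suc (suc (suc (suc _))))))} ()

isOne : ℕ → Bool
isOne 1 = true
isOne _ = false

heap-noA : ∀ {k} → k ≤ 2 → isOne k ≡ false → NoA (heapValue k)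
heap-noA {0} _ _ = refl , refl
heap-noA {2} _ _ = refl , refl
heap-noA {suc (suc (suc _))} (s≤s (s≤s ())) _

≤1⇒¬carriesB : ∀ {k} → k ≤ 1 → carriesB k ≡ false
≤1⇒¬carriesB {0} _ = refl
≤1⇒¬carriesB {1} _ = refl
≤1⇒¬carriesB {suc (suc _)} (s≤s ())

tailOne-η : ∀ z → tailOf z ≡ one → z ≡ (a^ aBit z b^ bExp z · one)
tailOne-η (a^ _ b^ _ · _) refl = refl

win-by : ∀ {G k rest z} → G ↭ k ∷ rest → value rest ≡ z → inP (value G) ≡ false →
         (inP (heapValue k ⊗ z) ≡ false → WinningOption k z) → HasWinningMove G
win-by p refl ∉P win = winningOption⇒winningMove p (win (trans (cong inP (sym (value-↭ p))) ∉P))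

⊗-tailOne : ∀ x y → tailOf x ≡ one → tailOf y ≡ one → tailOf (x ⊗ y) ≡ one
⊗-tailOne (a^ _ b^ _ · _) (a^ _ b^ _ · _) refl refl = refl

value-tailOne : ∀ {M rest} → M ≤ 4 → All (_≤ M) rest → tailOf (value rest) ≡ one
value-tailOne M≤4 bound = value-preserves (λ x → tailOf x ≡ one) refl ⊗-tailOne (All.map (λ k≤M → heap-tailOne (≤-trans k≤M M≤4)) bound)

value-tailNotD : ∀ {M rest} → M ≤ 6 → All (_≤ M) rest → TailNotD (tailOf (value rest))
value-tailNotD M≤6 bound = value-preserves (λ x → TailNotD (tailOf x)) (inj₁ refl) ⊗-tailNotD (All.map (λ k≤M → heap-tailNotD (≤-trans k≤M M≤6)) bound)

value-isAPower : ∀ {rest} → All (λ k → carriesB k ≡ false) rest → IsAPower (value rest)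
value-isAPower none = value-preserves IsAPower (refl , refl) ⊗-isAPower (All.map ¬carriesB⇒isAPower none)

value-tailAtMost : ∀ {n rest} → All (_≤ 7 + n) rest → TailAtMost n (tailOf (value rest))
value-tailAtMost {n} bound = value-preserves (λ x → TailAtMost n (tailOf x)) (inj₁ refl) (⊗-tailAtMost n) (All.map (heap-tailAtMost n) bound)

winningMove-max2 : ∀ {G rest} → G ↭ 2 ∷ rest → All (_≤ 2) rest → inP (value G) ≡ false → HasWinningMove G
winningMove-max2 {G} {rest} p bound ∉P with aBit (value rest) in eι | odd (bExp (value rest)) in eo
... | false | _ = win-by p (tailOne-η _ (value-tailOne (s≤s (s≤s z≤n)) bound)) ∉P
                   (λ ∉P′ → winningOption-2 _ _ ∉P′ λ (ι≡ , _) → true≢false (trans (sym ι≡) eι))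
... | true | false = win-by p (tailOne-η _ (value-tailOne (s≤s (s≤s z≤n)) bound)) ∉P
                   (λ ∉P′ → winningOption-2 _ _ ∉P′ λ (_ , o≡) → true≢false (trans (sym o≡) eo))
... | true | true with findHeap isOne rest
...   | inj₂ no1 = ⊥-elim (true≢false (trans (sym eι) (proj₁ noA)))
  where
  noA : NoA (value rest)
  noA = value-preserves NoA (refl , refl) ⊗-noA (All.zipWith (λ (k≤2 , ¬1) → heap-noA k≤2 ¬1) (bound , no1))
...   | inj₁ (0 , _ , () , _)
...   | inj₁ (suc (suc _) , _ , () , _)
...   | inj₁ (1 , rest′ , _ , q) with All-↭-∷ bound q
...     | _ , bound′ = win-by p′ (tailOne-η _ (value-tailOne (s≤s (s≤s z≤n)) (s≤s (s≤s z≤n) ∷ bound′))) ∉P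
                    (λ ∉P′ → winningOption-1 _ _ ∉P′ (inj₂ (ι′≡false , o′≡false)))
  where
  p′ : G ↭ 1 ∷ 2 ∷ rest′
  p′ = ↭-trans p (↭-trans (↭-prep 2 q) (↭-swap 2 1 ↭-refl))
  rest≡ : value rest ≡ heapValue 1 ⊗ value rest′
  rest≡ = value-↭ q
  ι′≡false : aBit (value rest′) ≡ false
  ι′≡false = not≡true⇒≡false (trans (cong aBit (sym rest≡)) eι)
  o′≡false : not (odd (bExp (value rest′))) ≡ false
  o′≡false = cong not (trans (cong (λ w → odd (bExp w)) (sym rest≡)) eo)

winningMove-max : ∀ {G} M rest → G ↭ M ∷ rest → All (_≤ M) rest → inP (value G) ≡ false → 1 ≤ M → HasWinningMove G
winningMove-max 1 rest p bound ∉P _ =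
  win-by p (isAPower-η (value rest) (value-isAPower (All.map ≤1⇒¬carriesB bound)) refl) ∉P
    (λ ∉P′ → winningOption-1 _ 0 ∉P′ (inj₁ refl))
winningMove-max 2 rest p bound ∉P _ = winningMove-max2 p bound ∉P
winningMove-max 3 rest p bound ∉P _ = win-by p (tailOne-η _ (value-tailOne (n≤1+n 3) bound)) ∉P (winningOption-3 _ _)
winningMove-max 4 rest p bound ∉P _ = win-by p (tailOne-η _ (value-tailOne ≤-refl bound)) ∉P (winningOption-4 _ _)
winningMove-max 5 rest p bound ∉P _ = win-by p refl ∉P (winningOption-5 _ (value-tailNotD (n≤1+n 5) bound))
winningMove-max 6 rest p bound ∉P _ = win-by p refl ∉P (winningOption-6 _ (value-tailNotD ≤-refl bound))
winningMove-max {G} (suc (suc (suc (suc (suc (suc (suc n))))))) rest p bound ∉P _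
  with bExp (heapValue (7 + n) ⊗ value rest) ≟ n
... | no J≢n = win-by p refl ∉P λ ∉P′ → winningOption-largestHeap n (value rest) (value-tailAtMost bound) ∉P′ J≢n
... | yes J≡n with findHeap carriesB rest
...   | inj₂ none = win-by p z≡ ∉P λ _ → subst (λ m → WinningOption (7 + m) _) 0≡n (winningOption-7-with-a _)
  where
  z≡ : value rest ≡ (a^ aBit (value rest) b^ 0 · one)
  z≡ = isAPower-η (value rest) (value-isAPower none) refl
  0≡n : 0 ≡ n
  0≡n = trans (cong (λ z → bExp (heapValue (7 + n) ⊗ z)) (sym z≡)) J≡n
...   | inj₁ (h , rest′ , h-carriesB , q) with All-↭-∷ bound q
...     | h≤ , bound′ = winningOption⇒winningMove p′
          (winningOption-bExp≡n n h x (tail-largestHeap n (value rest′) (value-tailAtMost bound′)) h-carriesB h≤ bExp≡n)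
  where
  p′ : G ↭ h ∷ 7 + n ∷ rest′
  p′ = ↭-trans p (↭-trans (↭-prep (7 + n) q) (↭-swap (7 + n) h ↭-refl))
  x = value (7 + n ∷ rest′)
  bExp≡n : bExp (heapValue h ⊗ x) ≡ n
  bExp≡n = trans (cong bExp (trans (sym (value-↭ p′)) (value-↭ p))) J≡n

winningMove : ∀ G → inP (value G) ≡ false → 1 ≤ maxHeap G → HasWinningMove G
winningMove G ∉P 1≤M with ∈⇒↭ (maxHeap-∈ G 1≤M)
... | rest , p = winningMove-max (maxHeap G) rest p (proj₂ (All-↭-∷ (maxHeap-bounds G) p)) ∉P 1≤M

someMove : ∀ G → 1 ≤ maxHeap G → Σ Position (Move G)
someMove G 1≤M with ∈⇒↭ (maxHeap-∈ G 1≤M)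
... | rest , p = go (maxHeap G) 1≤M p
  where
  go : ∀ M → 1 ≤ M → G ↭ M ∷ rest → Σ Position (Move G)
  go 1             _ p = proj₁ (move-at p remove0) , proj₁ (proj₂ (move-at p remove0))
  go (suc (suc k)) _ p = proj₁ (move-at p (remove1 k)) , proj₁ (proj₂ (move-at p (remove1 k)))

allEmpty-value : ∀ {G} → All (_≤ 0) G → value G ≡ ε
allEmpty-value []          = refl
allEmpty-value (z≤n ∷ G≤0) = cong (ε ⊗_) (allEmpty-value G≤0)

allEmpty-noMove : ∀ {G G′} → All (_≤ 0) G → ¬ Move G G′
allEmpty-noMove G≤0 (move xs k ys R o) with All-↭-∷ G≤0 (shift k xs ys)
... | z≤n , _ with o
... | ()

¬1≤maxHeap⇒allEmpty : ∀ G → ¬ 1 ≤ maxHeap G → All (_≤ 0) G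
¬1≤maxHeap⇒allEmpty G ¬1≤M = All.map (λ k≤M → ≤-pred (≤-trans (s≤s k≤M) (≰⇒> ¬1≤M))) (maxHeap-bounds G)

-- Outcome classes

move⇒option : ∀ {G G′} → Move G G′ →
              Σ ℕ λ k → Σ Position λ R → Σ Elt λ z → HeapOption k R × value G ≡ heapValue k ⊗ z × value G′ ≡ value R ⊗ z
move⇒option (move xs k ys R o) =
  k , R , value (xs ++ ys) , o , value-↭ (shift k xs ys) , trans (value-↭ (shifts xs R)) (value-++ R (xs ++ ys))

inP-move : ∀ {G G′} → Move G G′ → inP (value G) ≡ true → inP (value G′) ≡ false
inP-move m ∈P with move⇒option m
... | k , R , z , o , G≡ , G′≡ = trans (cong inP G′≡) (inP-no-move-to-P o z (trans (cong inP (sym G≡)) ∈P))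

-- A heap of k beans weighs 2k − 1: a split lowers the total weight by 1, a removal by at least 2.
heapWeight : ℕ → ℕ
heapWeight zero    = 0
heapWeight (suc k) = suc (k + k)

weight : Position → ℕ
weight []      = 0
weight (k ∷ G) = heapWeight k + weight G

weight-++ : ∀ xs ys → weight (xs ++ ys) ≡ weight xs + weight ys
weight-++ []       ys = refl
weight-++ (k ∷ xs) ys rewrite weight-++ xs ys = sym (+-assoc (heapWeight k) (weight xs) (weight ys))

option-weight< : ∀ {k R} → HeapOption k R → weight R < heapWeight k
option-weight< (split i j)   = ≤-reflexive (arith i j)
  where
  arith : ∀ i j → suc (suc (i + i) + (suc (j + j) + 0)) ≡ suc ((i + suc j) + (i + suc j))
  arith = solve-∀
option-weight< remove0       = s≤s z≤n
option-weight< (remove1 i)   = ≤-trans (≤-reflexive (arith i)) (n≤1+n _)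
  where
  arith : ∀ i → suc (suc (i + i) + 0) ≡ suc (i + suc i)
  arith = solve-∀
option-weight< (remove2 i j) = ≤-trans (m≤n+m _ 2) (≤-reflexive (sym (arith i j)))
  where
  arith : ∀ i j → suc (suc (i + suc j) + suc (i + suc j)) ≡ 2 + suc (suc (i + i) + (suc (j + j) + 0))
  arith = solve-∀

move-weight< : ∀ {G G′} → Move G G′ → weight G′ < weight G
move-weight< (move xs k ys R o) rewrite weight-++ xs (R ++ ys) | weight-++ xs (k ∷ ys) | weight-++ R ys =
  +-monoʳ-< (weight xs) (+-monoˡ-< (weight ys) (option-weight< o))

mutual
  inP⇒IsP : ∀ n G → weight G < n → inP (value G) ≡ true → IsP G
  inP⇒IsP (suc n) G w< ∈P with 1 ≤? maxHeap G
  ... | no ¬1≤M = ⊥-elim (true≢false (trans (sym ∈P) (cong inP (allEmpty-value (¬1≤maxHeap⇒allEmpty G ¬1≤M)))))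
  ... | yes 1≤M = isP (someMove G 1≤M) λ G′ m → ¬inP⇒IsN n G′ (≤-trans (move-weight< m) (≤-pred w<)) (inP-move m ∈P)

  ¬inP⇒IsN : ∀ n G → weight G < n → inP (value G) ≡ false → IsN G
  ¬inP⇒IsN (suc n) G w< ∉P with 1 ≤? maxHeap G
  ... | no ¬1≤M = terminal λ G′ → allEmpty-noMove (¬1≤maxHeap⇒allEmpty G ¬1≤M)
  ... | yes 1≤M with winningMove G ∉P 1≤M
  ...   | G′ , m , ∈P = toP m (inP⇒IsP n G′ (≤-trans (move-weight< m) (≤-pred w<)) ∈P)

IsP⇒¬IsN : ∀ {G} → IsP G → ¬ IsN G
IsP⇒¬IsN (isP (G′ , m) _)  (terminal noMove) = noMove G′ m
IsP⇒¬IsN (isP _ optionsN)  (toP m G′-P)      = IsP⇒¬IsN G′-P (optionsN _ m)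

IsP⇔inP : ∀ G → IsP G ⇔ inP (value G) ≡ true
IsP⇔inP G = mk⇔ IsP⇒inP (inP⇒IsP (suc (weight G)) G ≤-refl)
  where
  IsP⇒inP : IsP G → inP (value G) ≡ true
  IsP⇒inP G-P with inP (value G) in ∉P
  ... | true  = refl
  ... | false = ⊥-elim (IsP⇒¬IsN G-P (¬inP⇒IsN (suc (weight G)) G ≤-refl ∉P))

inP⇔∈𝒫 : ∀ w → inP (eval w) ≡ true ⇔ w ∈𝒫
inP⇔∈𝒫 w = mk⇔ (inP⇒∈𝒫 w) (∈𝒫⇒inP w)

mainTheorem3 : ∀ (G : Position) → All (1 ≤_) G → (IsP G ⇔ (Φ G ∈𝒫))
mainTheorem3 G _ = ⇔-trans (IsP⇔inP G) (subst (λ x → inP x ≡ true ⇔ Φ G ∈𝒫) (sym (value≡evalΦ G)) (inP⇔∈𝒫 (Φ G)))
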